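{- Let $G$ be an $(s,k)$-edge-connected graph such that $s$ is not incident with a cut-edge, and let $I$ be an independent set of $L(G,s,k)$ with $|I|\geq 2$ and $I\neq V(L(G,s,k))$. Then among the dangerous sets of $G$ that contain the end other than $s$ of every edge in $I$, there is a unique inclusion-minimal one (in particular at least one such dangerous set exists).
   Context: All graphs are finite loopless multigraphs. $\delta(X)$ is the set of edges with exactly one end in $X$. A graph $G$ is $(s,k)$-edge-connected if $G$ has at least three vertices, $s\in V(G)$, $k$ is a positive integer, and any two vertices of $G$ different from $s$ are joined by $k$ pairwise edge-disjoint paths in $G$ (which may pass through $s$). Lifting edges $sv,sw$ means deleting them and adding $vw$ if $v\ne w$, only deleting them if $v=w$; result $G_{v,w}$. $sv,sw$ are $k$-liftable if $G_{v,w}$ is $(s,k)$-edge-connected. $L(G,s,k)$ has vertex set the edges of $G$ incident with $s$, adjacent iff $k$-liftable. A set $A\subseteq V(G)\setminus\{s\}$ is ($k$-)dangerous if $A\ne\emptyset$, $V(G)\setminus(A\cup\{s\})\neq\emptyset$ and $|\delta(A)|\le k+1$. -}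

module Defs where

open import Data.Nat using (ℕ; zero; suc; _≤_; _+_)
open import Data.Fin using (Fin; zero; suc; _≟_)
open import Data.Fin.Subset using (Subset; _∈_; _∉_; _⊆_; ∣_∣; Nonempty)
open import Data.Bool using (Bool; true; false; if_then_else_; _∨_; _xor_; not)
open import Data.List using (List; []; _∷_; _++_; length; lookup)
open import Data.List.Relation.Unary.All using (All)
open import Data.List.Relation.Unary.Unique.Propositional using (Unique)
open import Data.List.Relation.Binary.Disjoint.Propositional using (Disjoint)
open import Data.Vec using (tabulate)
open import Data.Fin.Subset.Properties using (_∈?_)
open import Data.Product using (Σ; _×_; _,_; proj₁; proj₂; ∃)
open import Data.Sum using (_⊎_)
open import Relation.Nullary using (¬_; Dec; yes; no)
open import Relation.Nullary.Decidable using (⌊_⌋)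
open import Relation.Binary.PropositionalEquality using (_≡_; _≢_)

-- A (finite, multi-)graph on vertex set Fin n is given by its list of edges;
-- edge number i (i : Fin (length G)) has ends  lookup G i.
Graph : ℕ → Set
Graph n = List (Fin n × Fin n)

Edge : ∀ {n} → Graph n → Set
Edge G = Fin (length G)

ends : ∀ {n} (G : Graph n) → Edge G → Fin n × Fin n
ends G e = lookup G e

Loopless : ∀ {n} → Graph n → Set
Loopless G = All (λ p → proj₁ p ≢ proj₂ p) G

keepWhere : ∀ {A : Set} (xs : List A) → (Fin (length xs) → Bool) → List A
keepWhere [] p = []
keepWhere (x ∷ xs) p with p zero
... | true  = x ∷ keepWhere xs (λ i → p (suc i))
... | false = keepWhere xs (λ i → p (suc i))

deleteEdge : ∀ {n} (G : Graph n) → Edge G → Graph n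
deleteEdge G e = keepWhere G (λ i → not ⌊ i ≟ e ⌋)

Traverses : ∀ {n} (G : Graph n) → Edge G → Fin n → Fin n → Set
Traverses G e u w = ends G e ≡ (u , w) ⊎ ends G e ≡ (w , u)

data Walk {n} (G : Graph n) : Fin n → Fin n → Set where
  []   : ∀ {u} → Walk G u u
  step : ∀ {u w v} (e : Edge G) → Traverses G e u w → Walk G w v → Walk G u v

walkVertices : ∀ {n} {G : Graph n} {u v} → Walk G u v → List (Fin n)
walkVertices {u = u} []           = u ∷ []
walkVertices {u = u} (step e _ p) = u ∷ walkVertices p

walkEdges : ∀ {n} {G : Graph n} {u v} → Walk G u v → List (Edge G)
walkEdges []           = []
walkEdges (step e _ p) = e ∷ walkEdges p

IsPath : ∀ {n} {G : Graph n} {u v} → Walk G u v → Set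
IsPath p = Unique (walkVertices p)

Path : ∀ {n} (G : Graph n) → Fin n → Fin n → Set
Path G u v = Σ (Walk G u v) IsPath

EdgeDisjointPaths : ∀ {n} (G : Graph n) → ℕ → Fin n → Fin n → Set
EdgeDisjointPaths G k u v =
  Σ (Fin k → Path G u v) λ P →
    ∀ i j → i ≢ j → Disjoint (walkEdges (proj₁ (P i))) (walkEdges (proj₁ (P j)))

SKEdgeConnected : ∀ {n} (G : Graph n) → Fin n → ℕ → Set
SKEdgeConnected {n} G s k =
  3 ≤ n × 1 ≤ k ×
  (∀ u v → u ≢ s → v ≢ s → u ≢ v → EdgeDisjointPaths G k u v)

IncidentWith : ∀ {n} (G : Graph n) → Fin n → Edge G → Set
IncidentWith G s e = proj₁ (ends G e) ≡ s ⊎ proj₂ (ends G e) ≡ s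

CutEdge : ∀ {n} (G : Graph n) → Edge G → Set
CutEdge G e = ¬ Path (deleteEdge G e) (proj₁ (ends G e)) (proj₂ (ends G e))

-- the end of e other than s (meaningful when e is incident with s)
otherEnd : ∀ {n} (G : Graph n) → Fin n → Edge G → Fin n
otherEnd G s e with proj₁ (ends G e) ≟ s
... | yes _ = proj₂ (ends G e)
... | no _  = proj₁ (ends G e)

lift : ∀ {n} (G : Graph n) → Fin n → Edge G → Edge G → Graph n
lift G s e f with otherEnd G s e ≟ otherEnd G s f
... | yes _ = keepWhere G (λ i → not (⌊ i ≟ e ⌋ ∨ ⌊ i ≟ f ⌋))
... | no _  = keepWhere G (λ i → not (⌊ i ≟ e ⌋ ∨ ⌊ i ≟ f ⌋))
                ++ ((otherEnd G s e , otherEnd G s f) ∷ [])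

Liftable : ∀ {n} (G : Graph n) → Fin n → ℕ → Edge G → Edge G → Set
Liftable G s k e f = SKEdgeConnected (lift G s e f) s k

LVertex : ∀ {n} (G : Graph n) → Fin n → Set
LVertex G s = Σ (Edge G) (IncidentWith G s)

LAdjacent : ∀ {n} (G : Graph n) (s : Fin n) → ℕ → LVertex G s → LVertex G s → Set
LAdjacent G s k (e , _) (f , _) = e ≢ f × Liftable G s k e f

-- A set I of vertices of L(G,s,k), given as a subset of E(G) all of whose
-- members are incident with s
IsLVertexSet : ∀ {n} (G : Graph n) → Fin n → Subset (length G) → Set
IsLVertexSet G s I = ∀ e → e ∈ I → IncidentWith G s e

IndependentInL : ∀ {n} (G : Graph n) → Fin n → ℕ → Subset (length G) → Set
IndependentInL G s k I =
  ∀ e f → (ie : e ∈ I) → (if : f ∈ I) →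
    (pe : IncidentWith G s e) → (pf : IncidentWith G s f) →
    ¬ LAdjacent G s k (e , pe) (f , pf)

crossesB : ∀ {n} → Subset n → Fin n × Fin n → Bool
crossesB X (a , b) = ⌊ a ∈? X ⌋ xor ⌊ b ∈? X ⌋

δ : ∀ {n} (G : Graph n) → Subset n → Subset (length G)
δ G X = tabulate (λ e → crossesB X (ends G e))

Dangerous : ∀ {n} (G : Graph n) → Fin n → ℕ → Subset n → Set
Dangerous G s k A =
  s ∉ A × Nonempty A × (∃ λ x → x ∉ A × x ≢ s) × ∣ δ G A ∣ ≤ k + 1

-- Two edges e, f ∈ I are not liftable, so by Menger's theorem (via augmenting 0/1-flows) the
-- lifted graph has a cut of fewer than k edges separating two vertices other than s; lifting
-- removes at most two edges from a cut, and only when both lifted ends lie inside, so this cut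
-- is a dangerous set of G containing the ends of e and f.
-- Posimodularity, |δ(X − Y)| + |δ(Y − X)| + 2 d(X ∩ Y, V − (X ∪ Y)) ≤ |δ(X)| + |δ(Y)|, shows
-- that two dangerous sets sharing the ends of two s-edges are nested; this gives uniqueness.
-- For existence, a dangerous set X containing the ends of e and f is enlarged to contain the
-- end of each further g ∈ I: one of the dangerous sets obtained from (e, g) and (f, g) is
-- nested with X, unless the three sets form a "triangle". Then for k ≤ 1 an s-edge of I would
-- be a cut edge, and for k ≥ 2 the union of the triangle has at most three edges in its cut,
-- so it is dangerous unless it contains every vertex but s, in which case it would receive
-- four s-edges, one of them outside I.

module Submission where

open import Defs
open import Data.Bool using (Bool; true; false; not; _∧_; _∨_; _xor_; T; if_then_else_)
open import Data.Bool.Properties using (T-∧; ∧-zeroʳ; ∧-identityʳ; ∨-zeroʳ; xor-identityʳ)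
open import Data.Empty using (⊥-elim)
open import Data.Fin using (Fin; zero; suc; _≟_; punchIn; punchOut)
open import Data.Fin.Properties using (any?; all?; punchInᵢ≢i; punchIn-punchOut; punchIn-injective)
open import Data.Fin.Subset
  using (Subset; _∈_; _∉_; _⊆_; _⊂_; _⊃_; ∣_∣; _∩_; _∪_; _─_; ∁; ⁅_⁆; Nonempty) renaming (⊥ to ∅)
open import Data.Fin.Subset.Properties
  using (_∈?_; _⊆?_; anySubset?; nonempty?; x∈⁅x⁆; x∈⁅y⁆⇒x≡y; x∈p⇒x∉∁p; x∉p⇒x∈∁p; p⊆p∪q; q⊆p∪q;
         x∈p∪q⁻; x∈p∪q⁺; x∈p∩q⁺; x∈p∧x∉q⇒x∈p─q; p─q⊆p; ∣⊥∣≡0; ∣⁅x⁆∣≡1; p⊆q⇒∣p∣≤∣q∣; ⊆-antisym)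
open import Data.Fin.Subset.Induction using (Acc; acc; ⊂-wellFounded; ⊃-wellFounded)
open import Data.List as List using (List; []; _∷_; length; _++_; allFin)
open import Data.List.Membership.Propositional using () renaming (_∈_ to _∈ₗ_)
open import Data.List.Membership.Propositional.Properties using (∈-lookup; ∈-allFin)
open import Data.List.Properties using (length-tabulate; map-++)
open import Data.List.Relation.Binary.Disjoint.Propositional using (Disjoint)
open import Data.List.Relation.Unary.All as All using (All; []; _∷_)
open import Data.List.Relation.Unary.All.Properties using (¬Any⇒All¬) renaming (tabulate⁺ to all-tabulate⁺)
open import Data.List.Relation.Unary.AllPairs using ([]; _∷_)
open import Data.List.Relation.Unary.Any as Any using (here; there)
open import Data.List.Relation.Unary.Unique.Propositional using (Unique)
open import Data.List.Relation.Unary.Unique.Propositional.Properties using () renaming (tabulate⁺ to unique-tabulate⁺)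
open import Data.Nat using (ℕ; zero; suc; _+_; _*_; _≤_; _<_; _≤ᵇ_; _≤?_; _<?_; z≤n; s≤s)
open import Data.Nat.Induction using (<-wellFounded)
import Data.Nat.ListAction as ListAction
open import Data.Nat.ListAction.Properties using (sum-++)
open import Data.Nat.Properties hiding (_≟_)
open import Data.Nat.Solver using (module +-*-Solver)
open import Data.Product using (Σ; _×_; _,_; proj₁; proj₂; ∃; ∃₂)
open import Data.Product.Properties using (≡-dec)
open import Data.Sum using (_⊎_; inj₁; inj₂; [_,_])
open import Data.Unit using (tt)
open import Data.Vec using (Vec; []; _∷_; tabulate; lookup)
open import Data.Vec.Functional using (updateAt)
open import Data.Vec.Functional.Properties using (updateAt-updates; updateAt-minimal)
open import Data.Vec.Properties using (lookup-zipWith; lookup-map; []=⇒lookup; lookup⇒[]=)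
open import Function using (_∘_; const)
open import Function.Bundles using (Equivalence)
open import Relation.Binary.Definitions using (DecidableEquality)
open import Relation.Binary.PropositionalEquality hiding ([_])
open import Relation.Nullary using (¬_; Dec; yes; no; contradiction; ¬?; _×-dec_; _⊎-dec_)
open import Relation.Nullary.Decidable using (⌊_⌋; map′; _→-dec_)
open import Relation.Unary using (Decidable)
open import Algebra.Properties.Semiring.Sum +-*-semiring
  using (sum; sum-remove; sum-cong-≗; sum-replicate-zero; ∑-distrib-+; ∑-comm; *-distribˡ-sum)
open import Algebra.Properties.CommutativeSemigroup +-commutativeSemigroup using (xy∙z≈xz∙y)
open +-*-Solver using (solve; _:+_; _:*_; _:=_; con)

𝟙 : Bool → ℕ
𝟙 true  = 1
𝟙 false = 0

sum-mono-≤ : ∀ {m} {f g : Fin m → ℕ} → (∀ i → f i ≤ g i) → sum f ≤ sum g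
sum-mono-≤ {zero}  f≤g = z≤n
sum-mono-≤ {suc m} f≤g = +-mono-≤ (f≤g zero) (sum-mono-≤ (f≤g ∘ suc))

sum-zero : ∀ {m} {f : Fin m → ℕ} → (∀ i → f i ≡ 0) → sum f ≡ 0
sum-zero {m} f≡0 = trans (sum-cong-≗ f≡0) (sum-replicate-zero m)

sum-split : ∀ {m} (f : Fin (suc m) → ℕ) e → sum f ≡ f e + sum (f ∘ punchIn e)
sum-split f e = sum-remove {i = e} f

sum-point : ∀ {m} {f : Fin m → ℕ} e → (∀ i → i ≢ e → f i ≡ 0) → sum f ≡ f e
sum-point {suc m} {f} e f≡0 = begin
  sum f                       ≡⟨ sum-split f e ⟩
  f e + sum (f ∘ punchIn e)   ≡⟨ cong (f e +_) (sum-zero (λ i → f≡0 _ (punchInᵢ≢i e i))) ⟩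
  f e + 0                     ≡⟨ +-identityʳ (f e) ⟩
  f e                         ∎
  where open ≡-Reasoning

sum-update : ∀ {m} {f g : Fin m → ℕ} e → (∀ i → i ≢ e → f i ≡ g i) → sum f + g e ≡ sum g + f e
sum-update {suc m} {f} {g} e f≡g = begin
  sum f + g e                      ≡⟨ cong (_+ g e) (sum-split f e) ⟩
  f e + sum (f ∘ punchIn e) + g e  ≡⟨ cong (λ r → f e + r + g e) rest ⟩
  f e + r + g e                    ≡⟨ +-assoc (f e) r (g e) ⟩
  f e + (r + g e)                  ≡⟨ +-comm (f e) (r + g e) ⟩
  r + g e + f e                    ≡⟨ cong (_+ f e) (+-comm r (g e)) ⟩
  g e + r + f e                    ≡⟨ cong (_+ f e) (sym (sum-split g e)) ⟩
  sum g + f e                      ∎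
  where
  open ≡-Reasoning
  r = sum (g ∘ punchIn e)
  rest : sum (f ∘ punchIn e) ≡ r
  rest = sum-cong-≗ (λ i → f≡g _ (punchInᵢ≢i e i))

sum-pos⇒∃ : ∀ {m} (f : Fin m → ℕ) → 0 < sum f → ∃ λ i → 0 < f i
sum-pos⇒∃ f pos with any? (λ i → 0 <? f i)
... | yes found = found
... | no none = contradiction (sum-zero (λ i → n≤0⇒n≡0 (≮⇒≥ (λ p → none (i , p))))) (>⇒≢ pos)

sum-linear₃ : ∀ {m} (f g h : Fin m → ℕ) → sum (λ i → f i + g i + 2 * h i) ≡ sum f + sum g + 2 * sum h
sum-linear₃ f g h = begin
  sum (λ i → f i + g i + 2 * h i)          ≡⟨ ∑-distrib-+ (λ i → f i + g i) (λ i → 2 * h i) ⟩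
  sum (λ i → f i + g i) + sum (λ i → 2 * h i) ≡⟨ cong₂ _+_ (∑-distrib-+ f g) (sym (*-distribˡ-sum 2 h)) ⟩
  sum f + sum g + 2 * sum h                 ∎
  where open ≡-Reasoning

sum-linear₃′ : ∀ {m} (f g h : Fin m → ℕ) → sum (λ i → f i + g i + h i) ≡ sum f + sum g + sum h
sum-linear₃′ f g h = trans (∑-distrib-+ (λ i → f i + g i) h) (cong (_+ sum h) (∑-distrib-+ f g))

unique-count : ∀ {m} (w : Fin m → ℕ) {xs : List (Fin m)} →
  Unique xs → All (λ i → 1 ≤ w i) xs → length xs ≤ sum w
unique-count w {[]}     _              _          = z≤n
unique-count w {x ∷ xs} (x∉xs ∷ uniq) (wx ∷ wxs) = begin
  suc (length xs)   ≡⟨ +-comm 1 (length xs) ⟩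
  length xs + 1     ≤⟨ +-mono-≤ (unique-count w′ uniq (allw′ x∉xs wxs)) wx ⟩
  sum w′ + w x      ≡⟨ sum-update x (λ i i≢x → updateAt-minimal i x w i≢x) ⟩
  sum w + w′ x      ≡⟨ cong (sum w +_) (updateAt-updates x w) ⟩
  sum w + 0         ≡⟨ +-identityʳ (sum w) ⟩
  sum w             ∎
  where
  open ≤-Reasoning
  w′ = updateAt w x (const 0)
  allw′ : ∀ {ys} → All (x ≢_) ys → All (λ i → 1 ≤ w i) ys → All (λ i → 1 ≤ w′ i) ys
  allw′ []            []         = []
  allw′ (x≢y ∷ x≢ys) (wy ∷ wys) =
    subst (1 ≤_) (sym (updateAt-minimal _ x w (x≢y ∘ sym))) wy ∷ allw′ x≢ys wys

∣tabulate∣≡sum : ∀ {m} (g : Fin m → Bool) → ∣ tabulate g ∣ ≡ sum (𝟙 ∘ g)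
∣tabulate∣≡sum {zero}  g = refl
∣tabulate∣≡sum {suc m} g with g zero
... | true  = cong suc (∣tabulate∣≡sum (g ∘ suc))
... | false = ∣tabulate∣≡sum (g ∘ suc)

∈?≡lookup : ∀ {m} x (p : Subset m) → ⌊ x ∈? p ⌋ ≡ lookup p x
∈?≡lookup zero    (true  ∷ p) = refl
∈?≡lookup zero    (false ∷ p) = refl
∈?≡lookup (suc x) (_ ∷ p) with x ∈? p | ∈?≡lookup x p
... | yes _ | eq = eq
... | no _  | eq = eq

∉⇒lookup≡false : ∀ {m} {x} {p : Subset m} → x ∉ p → lookup p x ≡ false
∉⇒lookup≡false {x = x} {p} x∉p with lookup p x in eq
... | true  = contradiction (lookup⇒[]= x p eq) x∉p
... | false = refl

lookup≡false⇒∉ : ∀ {m} {x} {p : Subset m} → lookup p x ≡ false → x ∉ p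
lookup≡false⇒∉ {x = x} {p} eq x∈p with trans (sym ([]=⇒lookup x∈p)) eq
... | ()

lookup-∩ : ∀ {m} (p q : Subset m) i → lookup (p ∩ q) i ≡ lookup p i ∧ lookup q i
lookup-∩ p q i = lookup-zipWith _∧_ i p q

lookup-∪ : ∀ {m} (p q : Subset m) i → lookup (p ∪ q) i ≡ lookup p i ∨ lookup q i
lookup-∪ p q i = lookup-zipWith _∨_ i p q

lookup-─ : ∀ {m} (p q : Subset m) i → lookup (p ─ q) i ≡ lookup p i ∧ not (lookup q i)
lookup-─ (x ∷ p) (true  ∷ q) zero    = sym (∧-zeroʳ x)
lookup-─ (x ∷ p) (false ∷ q) zero    = sym (∧-identityʳ x)
lookup-─ (_ ∷ p) (_ ∷ q)     (suc i) = lookup-─ p q i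

lookup-∁ : ∀ {m} (p : Subset m) i → lookup (∁ p) i ≡ not (lookup p i)
lookup-∁ p i = lookup-map i not p

∉∪ : ∀ {n} {x} {X Y : Subset n} → x ∉ X → x ∉ Y → x ∉ X ∪ Y
∉∪ {X = X} {Y} x∉X x∉Y x∈X∪Y with x∈p∪q⁻ X Y x∈X∪Y
... | inj₁ x∈X = x∉X x∈X
... | inj₂ x∈Y = x∉Y x∈Y

∈q⇒∉p─q : ∀ {n} {x} {X Y : Subset n} → x ∈ Y → x ∉ X ─ Y
∈q⇒∉p─q {x = x} {X} {Y} x∈Y = lookup≡false⇒∉ (begin
  lookup (X ─ Y) x              ≡⟨ lookup-─ X Y x ⟩
  lookup X x ∧ not (lookup Y x) ≡⟨ cong (λ b → lookup X x ∧ not b) ([]=⇒lookup x∈Y) ⟩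
  lookup X x ∧ false            ≡⟨ ∧-zeroʳ (lookup X x) ⟩
  false                         ∎)
  where open ≡-Reasoning

no-difference⇒⊆ : ∀ {n} {X Y : Subset n} → ¬ (∃ λ z → z ∈ X × z ∉ Y) → X ⊆ Y
no-difference⇒⊆ {Y = Y} none {z} z∈X with z ∈? Y
... | yes z∈Y = z∈Y
... | no  z∉Y = contradiction (z , z∈X , z∉Y) none

∈⇒≢ : ∀ {n} {x y} {X : Subset n} → x ∉ X → y ∈ X → y ≢ x
∈⇒≢ x∉X y∈X refl = x∉X y∈X

∉p⇒∉p─q : ∀ {n} {x} {X Y : Subset n} → x ∉ X → x ∉ X ─ Y
∉p⇒∉p─q {X = X} {Y} x∉X = x∉X ∘ p─q⊆p X Y

two-members : ∀ {m} (S : Subset m) → 2 ≤ ∣ S ∣ → ∃₂ λ e f → e ≢ f × e ∈ S × f ∈ S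
two-members {m} S 2≤∣S∣ with any? (_∈? S)
... | no empty =
  contradiction (subst (∣ S ∣ ≤_) (∣⊥∣≡0 m) (p⊆q⇒∣p∣≤∣q∣ S⊆∅)) (<⇒≱ (≤-trans (s≤s z≤n) 2≤∣S∣))
  where
  S⊆∅ : S ⊆ ∅
  S⊆∅ x∈S = contradiction (_ , x∈S) empty
... | yes (e , e∈S) with any? (λ f → f ∈? S ×-dec ¬? (f ≟ e))
...   | yes (f , f∈S , f≢e) = e , f , f≢e ∘ sym , e∈S , f∈S
...   | no  only-e =
  contradiction (subst (∣ S ∣ ≤_) (∣⁅x⁆∣≡1 e) (p⊆q⇒∣p∣≤∣q∣ S⊆⁅e⁆)) (<⇒≱ 2≤∣S∣)
  where
  S⊆⁅e⁆ : S ⊆ ⁅ e ⁆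
  S⊆⁅e⁆ {f} f∈S with f ≟ e
  ... | yes refl = x∈⁅x⁆ e
  ... | no  f≢e  = contradiction (f , f∈S , f≢e) only-e

minimal-member : ∀ {m} {P : Subset m → Set} → Decidable P → ∀ {A} → P A →
  ∃ λ M → P M × (∀ B → P B → B ⊆ M → B ≡ M)
minimal-member {P = P} P? = descend (⊂-wellFounded _)
  where
  descend : ∀ {A} → Acc _⊂_ A → P A → ∃ λ M → P M × (∀ B → P B → B ⊆ M → B ≡ M)
  descend {A} (acc smaller) pA
    with anySubset? (λ B → P? B ×-dec (B ⊆? A ×-dec any? (λ x → x ∈? A ×-dec ¬? (x ∈? B))))
  ... | yes (B , pB , B⊂A) = descend (smaller B⊂A) pB
  ... | no  none = A , pA , λ B pB B⊆A →
        ⊆-antisym B⊆A (no-difference⇒⊆ (λ x∈A─B → none (B , pB , B⊆A , x∈A─B)))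

-- Cuts

other-bit : ∀ {a b} → (a xor b) ≡ true → b ≡ not a
other-bit {true}  {false} _ = refl
other-bit {false} {true}  _ = refl

crossesᵖ : ∀ {n} → Subset n → Fin n × Fin n → Bool
crossesᵖ X (a , b) = lookup X a xor lookup X b

module _ {n} (G : Graph n) where

  end₁ end₂ : Edge G → Fin n
  end₁ e = proj₁ (ends G e)
  end₂ e = proj₂ (ends G e)

  crosses : Subset n → Edge G → Bool
  crosses X e = crossesᵖ X (ends G e)

  ∣δ∣≡sum : ∀ X → ∣ δ G X ∣ ≡ sum (𝟙 ∘ crosses X)
  ∣δ∣≡sum X = trans (∣tabulate∣≡sum (crossesB X ∘ ends G))
    (sum-cong-≗ λ e → cong 𝟙 (cong₂ _xor_ (∈?≡lookup (end₁ e) X) (∈?≡lookup (end₂ e) X)))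

  traverse-crosses : ∀ {e a b} X → Traverses G e a b → a ∈ X → b ∉ X → crosses X e ≡ true
  traverse-crosses {e} X t a∈X b∉X with ends G e | t
  ... | _ | inj₁ refl rewrite []=⇒lookup a∈X | ∉⇒lookup≡false b∉X = refl
  ... | _ | inj₂ refl rewrite []=⇒lookup a∈X | ∉⇒lookup≡false b∉X = refl

  walk-crosses : ∀ {a b} (W : Walk G a b) X → a ∈ X → b ∉ X →
    ∃ λ e → e ∈ₗ walkEdges W × crosses X e ≡ true
  walk-crosses []                  X a∈X b∉X = contradiction a∈X b∉X
  walk-crosses (step {w = w} e t W) X a∈X b∉X with w ∈? X
  ... | yes w∈X = let (e′ , e′∈W , c) = walk-crosses W X w∈X b∉X in e′ , there e′∈W , c
  ... | no  w∉X = e , here refl , traverse-crosses X t a∈X w∉X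

  edge-disjoint-paths⇒cut : ∀ {k u v} → EdgeDisjointPaths G k u v → ∀ X → u ∈ X → v ∉ X → k ≤ ∣ δ G X ∣
  edge-disjoint-paths⇒cut {k} (P , disjoint) X u∈X v∉X = begin
    k                               ≡⟨ length-tabulate c ⟨
    length (List.tabulate c)        ≤⟨ unique-count (𝟙 ∘ crosses X) (unique-tabulate⁺ c-injective)
                                         (all-tabulate⁺ (≤-reflexive ∘ sym ∘ cong 𝟙 ∘ proj₂ ∘ proj₂ ∘ crossing)) ⟩
    sum (𝟙 ∘ crosses X)             ≡⟨ ∣δ∣≡sum X ⟨
    ∣ δ G X ∣                       ∎
    where
    open ≤-Reasoning
    crossing : ∀ i → ∃ λ e → e ∈ₗ walkEdges (proj₁ (P i)) × crosses X e ≡ true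
    crossing i = walk-crosses (proj₁ (P i)) X u∈X v∉X
    c : Fin k → Edge G
    c = proj₁ ∘ crossing
    c-injective : ∀ {i j} → c i ≡ c j → i ≡ j
    c-injective {i} {j} ci≡cj with i ≟ j
    ... | yes i≡j = i≡j
    ... | no  i≢j = contradiction
          (proj₁ (proj₂ (crossing i)) , subst (_∈ₗ walkEdges (proj₁ (P j))) (sym ci≡cj) (proj₁ (proj₂ (crossing j))))
          (disjoint i j i≢j)

  crosses-∁ : ∀ X e → crosses (∁ X) e ≡ crosses X e
  crosses-∁ X e rewrite lookup-∁ X (end₁ e) | lookup-∁ X (end₂ e) =
    not-xor-not (lookup X (end₁ e)) (lookup X (end₂ e))
    where
    not-xor-not : ∀ a b → (not a xor not b) ≡ (a xor b)
    not-xor-not true  true  = refl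
    not-xor-not true  false = refl
    not-xor-not false true  = refl
    not-xor-not false false = refl

  ∣δ∁∣≡∣δ∣ : ∀ X → ∣ δ G (∁ X) ∣ ≡ ∣ δ G X ∣
  ∣δ∁∣≡∣δ∣ X = trans (∣δ∣≡sum (∁ X)) (trans (sum-cong-≗ (cong 𝟙 ∘ crosses-∁ X)) (sym (∣δ∣≡sum X)))

  walk-crosses′ : ∀ {a b} (W : Walk G a b) X → (lookup X a xor lookup X b) ≡ true → ∃ λ e → crosses X e ≡ true
  walk-crosses′ {a} {b} W X a⊕b with lookup X a in a∈?
  ... | true  = let (e , _ , c) = walk-crosses W X (lookup⇒[]= a X a∈?) (lookup≡false⇒∉ (other-bit a⊕b)) in e , c
  ... | false = let (e , _ , c) = walk-crosses W (∁ X) (x∉p⇒x∈∁p (lookup≡false⇒∉ a∈?))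
                                                     (x∈p⇒x∉∁p (lookup⇒[]= b X (other-bit a⊕b)))
                in e , trans (sym (crosses-∁ X e)) c

keepWhere-lookup : ∀ {A : Set} (xs : List A) p (i′ : Fin (length (keepWhere xs p))) →
  ∃ λ i → p i ≡ true × List.lookup (keepWhere xs p) i′ ≡ List.lookup xs i
keepWhere-lookup []       p ()
keepWhere-lookup (x ∷ xs) p i′ with p zero in p0
keepWhere-lookup (x ∷ xs) p zero     | true = zero , p0 , refl
keepWhere-lookup (x ∷ xs) p (suc i′) | true with keepWhere-lookup xs (p ∘ suc) i′
... | i , pi , eq = suc i , pi , eq
keepWhere-lookup (x ∷ xs) p i′       | false with keepWhere-lookup xs (p ∘ suc) i′
... | i , pi , eq = suc i , pi , eq

module _ {n} (G : Graph n) where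

  deleted-edge : ∀ α (i′ : Edge (deleteEdge G α)) → ∃ λ i → i ≢ α × ends (deleteEdge G α) i′ ≡ ends G i
  deleted-edge α i′ with keepWhere-lookup G (λ i → not ⌊ i ≟ α ⌋) i′
  ... | i , kept , eq = i , i≢α kept , eq
    where
    i≢α : not ⌊ i ≟ α ⌋ ≡ true → i ≢ α
    i≢α kept with i ≟ α
    i≢α () | yes _
    ... | no i≢α = i≢α

  -- The ends of α are joined in G − α by a path, which crosses X at an edge other than α.
  alone-in-cut⇒cut-edge : ∀ X α → crosses G X α ≡ true → ∣ δ G X ∣ ≤ 1 → CutEdge G α
  alone-in-cut⇒cut-edge X α α-crosses ∣δX∣≤1 (W , _) = <⇒≱ (s≤s ∣δX∣≤1) (begin
    2                     ≤⟨ unique-count (𝟙 ∘ crosses G X) ((i≢α ∘ sym ∷ []) ∷ [] ∷ [])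
                               (≤-reflexive (sym (cong 𝟙 α-crosses)) ∷ ≤-reflexive (sym (cong 𝟙 i-crosses)) ∷ []) ⟩
    sum (𝟙 ∘ crosses G X) ≡⟨ ∣δ∣≡sum G X ⟨
    ∣ δ G X ∣             ∎)
    where
    open ≤-Reasoning
    crossing-in-H : ∃ λ i′ → crosses (deleteEdge G α) X i′ ≡ true
    crossing-in-H = walk-crosses′ (deleteEdge G α) W X α-crosses
    i′ = proj₁ crossing-in-H
    i = proj₁ (deleted-edge α i′)
    i≢α = proj₁ (proj₂ (deleted-edge α i′))
    i-crosses : crosses G X i ≡ true
    i-crosses = trans (cong (crossesᵖ X) (sym (proj₂ (proj₂ (deleted-edge α i′))))) (proj₂ crossing-in-H)

-- Uncrossing

valid : ∀ m → (Vec Bool m → Bool) → Bool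
valid zero    φ = φ []
valid (suc m) φ = valid m (φ ∘ (true ∷_)) ∧ valid m (φ ∘ (false ∷_))

valid⇒true : ∀ m φ → T (valid m φ) → ∀ v → T (φ v)
valid⇒true zero    φ t [] = t
valid⇒true (suc m) φ t (true  ∷ v) = valid⇒true m _ (proj₁ (Equivalence.to T-∧ t)) v
valid⇒true (suc m) φ t (false ∷ v) = valid⇒true m _ (proj₂ (Equivalence.to T-∧ t)) v

implied : ∀ {h c} → T (not h ∨ c) → T h → T c
implied {true} t _ = t

both : ∀ {x y} → T x → T y → T (x ∧ y)
both tx ty = Equivalence.from T-∧ (tx , ty)

-- Each per-edge inequality between the membership bits of the two ends is checked
-- on all assignments; a hypothesis h is encoded as not h ∨ ….
posimodular-table : Vec Bool 4 → Bool
posimodular-table (x₁ ∷ y₁ ∷ x₂ ∷ y₂ ∷ []) =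
  𝟙 ((x₁ ∧ not y₁) xor (x₂ ∧ not y₂)) + 𝟙 ((y₁ ∧ not x₁) xor (y₂ ∧ not x₂))
    + 2 * 𝟙 (((x₁ ∧ y₁) ∧ not (x₂ ∨ y₂)) ∨ (not (x₁ ∨ y₁) ∧ (x₂ ∧ y₂)))
  ≤ᵇ 𝟙 (x₁ xor x₂) + 𝟙 (y₁ xor y₂)

s-into-∩-table : Vec Bool 6 → Bool
s-into-∩-table (s₁ ∷ x₁ ∷ y₁ ∷ s₂ ∷ x₂ ∷ y₂ ∷ []) =
  not ((not s₁ ∨ not (x₁ ∨ y₁)) ∧ (not s₂ ∨ not (x₂ ∨ y₂))) ∨
  (𝟙 ((s₁ ∧ (x₂ ∧ y₂)) ∨ ((x₁ ∧ y₁) ∧ s₂))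
   ≤ᵇ 𝟙 (((x₁ ∧ y₁) ∧ not (x₂ ∨ y₂)) ∨ (not (x₁ ∨ y₁) ∧ (x₂ ∧ y₂))))

union₃-table : Vec Bool 6 → Bool
union₃-table (x₁ ∷ y₁ ∷ z₁ ∷ x₂ ∷ y₂ ∷ z₂ ∷ []) =
  not (((not x₁ ∨ (y₁ ∨ z₁)) ∧ (not y₁ ∨ (x₁ ∨ z₁)) ∧ (not z₁ ∨ (x₁ ∨ y₁)))
     ∧ ((not x₂ ∨ (y₂ ∨ z₂)) ∧ (not y₂ ∨ (x₂ ∨ z₂)) ∧ (not z₂ ∨ (x₂ ∨ y₂)))) ∨
  (𝟙 ((x₁ ∨ y₁ ∨ z₁) xor (x₂ ∨ y₂ ∨ z₂))
   ≤ᵇ 𝟙 (((x₁ ∧ y₁) ∧ not (x₂ ∨ y₂)) ∨ (not (x₁ ∨ y₁) ∧ (x₂ ∧ y₂)))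
      + 𝟙 (((x₁ ∧ z₁) ∧ not (x₂ ∨ z₂)) ∨ (not (x₁ ∨ z₁) ∧ (x₂ ∧ z₂)))
      + 𝟙 (((y₁ ∧ z₁) ∧ not (y₂ ∨ z₂)) ∨ (not (y₁ ∨ z₁) ∧ (y₂ ∧ z₂))))

s-into-table : Vec Bool 4 → Bool
s-into-table (s₁ ∷ x₁ ∷ s₂ ∷ x₂ ∷ []) =
  not ((not s₁ ∨ not x₁) ∧ (not s₂ ∨ not x₂)) ∨ (𝟙 ((s₁ ∧ x₂) ∨ (x₁ ∧ s₂)) ≤ᵇ 𝟙 (x₁ xor x₂))

⊆⇒implies : ∀ {m} {X Y : Subset m} → X ⊆ Y → ∀ a → T (not (lookup X a) ∨ lookup Y a)
⊆⇒implies {X = X} {Y} X⊆Y a with lookup X a in eq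
... | false = tt
... | true  rewrite []=⇒lookup (X⊆Y (lookup⇒[]= a X eq)) = tt

∉⇒⁅⁆⊆∁ : ∀ {m} {s : Fin m} {X : Subset m} → s ∉ X → ⁅ s ⁆ ⊆ ∁ X
∉⇒⁅⁆⊆∁ {s = s} s∉X x∈⁅s⁆ with x∈⁅y⁆⇒x≡y s x∈⁅s⁆
... | refl = x∉p⇒x∈∁p s∉X

module _ {n} (G : Graph n) where

  joins : Subset n → Subset n → Edge G → Bool
  joins A B e = (lookup A (end₁ G e) ∧ lookup B (end₂ G e)) ∨ (lookup B (end₁ G e) ∧ lookup A (end₂ G e))

  edgesBetween : Subset n → Subset n → ℕ
  edgesBetween A B = sum (𝟙 ∘ joins A B)

  diagonal : Subset n → Subset n → ℕ
  diagonal X Y = edgesBetween (X ∩ Y) (∁ (X ∪ Y))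

  posimodular : ∀ X Y → ∣ δ G (X ─ Y) ∣ + ∣ δ G (Y ─ X) ∣ + 2 * diagonal X Y ≤ ∣ δ G X ∣ + ∣ δ G Y ∣
  posimodular X Y = begin
    ∣ δ G (X ─ Y) ∣ + ∣ δ G (Y ─ X) ∣ + 2 * diagonal X Y
      ≡⟨ cong₂ (λ a b → a + b + 2 * diagonal X Y) (∣δ∣≡sum G (X ─ Y)) (∣δ∣≡sum G (Y ─ X)) ⟩
    sum (𝟙 ∘ crosses G (X ─ Y)) + sum (𝟙 ∘ crosses G (Y ─ X)) + 2 * diagonal X Y
      ≡⟨ sum-linear₃ (𝟙 ∘ crosses G (X ─ Y)) (𝟙 ∘ crosses G (Y ─ X)) (𝟙 ∘ joins (X ∩ Y) (∁ (X ∪ Y))) ⟨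
    sum (λ e → 𝟙 (crosses G (X ─ Y) e) + 𝟙 (crosses G (Y ─ X) e) + 2 * 𝟙 (joins (X ∩ Y) (∁ (X ∪ Y)) e))
      ≤⟨ sum-mono-≤ at-edge ⟩
    sum (λ e → 𝟙 (crosses G X e) + 𝟙 (crosses G Y e))
      ≡⟨ ∑-distrib-+ (𝟙 ∘ crosses G X) (𝟙 ∘ crosses G Y) ⟩
    sum (𝟙 ∘ crosses G X) + sum (𝟙 ∘ crosses G Y)
      ≡⟨ cong₂ _+_ (∣δ∣≡sum G X) (∣δ∣≡sum G Y) ⟨
    ∣ δ G X ∣ + ∣ δ G Y ∣ ∎
    where
    open ≤-Reasoning
    at-edge : ∀ e → 𝟙 (crosses G (X ─ Y) e) + 𝟙 (crosses G (Y ─ X) e) + 2 * 𝟙 (joins (X ∩ Y) (∁ (X ∪ Y)) e)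
                    ≤ 𝟙 (crosses G X e) + 𝟙 (crosses G Y e)
    at-edge e
      rewrite lookup-─ X Y (end₁ G e) | lookup-─ X Y (end₂ G e) | lookup-─ Y X (end₁ G e) | lookup-─ Y X (end₂ G e)
            | lookup-∩ X Y (end₁ G e) | lookup-∩ X Y (end₂ G e)
            | lookup-∁ (X ∪ Y) (end₁ G e) | lookup-∁ (X ∪ Y) (end₂ G e)
            | lookup-∪ X Y (end₁ G e) | lookup-∪ X Y (end₂ G e)
      = ≤ᵇ⇒≤ _ _ (valid⇒true 4 posimodular-table tt
          (lookup X (end₁ G e) ∷ lookup Y (end₁ G e) ∷ lookup X (end₂ G e) ∷ lookup Y (end₂ G e) ∷ []))

  s-into-∩≤diagonal : ∀ s X Y → s ∉ X ∪ Y → edgesBetween ⁅ s ⁆ (X ∩ Y) ≤ diagonal X Y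
  s-into-∩≤diagonal s X Y s∉X∪Y = sum-mono-≤ at-edge
    where
    outside : ∀ a → T (not (lookup ⁅ s ⁆ a) ∨ not (lookup X a ∨ lookup Y a))
    outside a rewrite sym (lookup-∪ X Y a) | sym (lookup-∁ (X ∪ Y) a) = ⊆⇒implies (∉⇒⁅⁆⊆∁ s∉X∪Y) a
    at-edge : ∀ e → 𝟙 (joins ⁅ s ⁆ (X ∩ Y) e) ≤ 𝟙 (joins (X ∩ Y) (∁ (X ∪ Y)) e)
    at-edge e
      rewrite lookup-∩ X Y (end₁ G e) | lookup-∩ X Y (end₂ G e)
            | lookup-∁ (X ∪ Y) (end₁ G e) | lookup-∁ (X ∪ Y) (end₂ G e)
            | lookup-∪ X Y (end₁ G e) | lookup-∪ X Y (end₂ G e)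
      = ≤ᵇ⇒≤ _ _ (implied (valid⇒true 6 s-into-∩-table tt
          (lookup ⁅ s ⁆ (end₁ G e) ∷ lookup X (end₁ G e) ∷ lookup Y (end₁ G e)
           ∷ lookup ⁅ s ⁆ (end₂ G e) ∷ lookup X (end₂ G e) ∷ lookup Y (end₂ G e) ∷ []))
          (both (outside (end₁ G e)) (outside (end₂ G e))))

  ∣δ∪∪∣≤diagonals : ∀ X Y Z → X ⊆ Y ∪ Z → Y ⊆ X ∪ Z → Z ⊆ X ∪ Y →
    ∣ δ G (X ∪ Y ∪ Z) ∣ ≤ diagonal X Y + diagonal X Z + diagonal Y Z
  ∣δ∪∪∣≤diagonals X Y Z X⊆ Y⊆ Z⊆ = begin
    ∣ δ G (X ∪ Y ∪ Z) ∣                     ≡⟨ ∣δ∣≡sum G (X ∪ Y ∪ Z) ⟩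
    sum (𝟙 ∘ crosses G (X ∪ Y ∪ Z))          ≤⟨ sum-mono-≤ at-edge ⟩
    sum (λ e → diag X Y e + diag X Z e + diag Y Z e) ≡⟨ sum-linear₃′ (diag X Y) (diag X Z) (diag Y Z) ⟩
    diagonal X Y + diagonal X Z + diagonal Y Z ∎
    where
    open ≤-Reasoning
    diag : Subset n → Subset n → Edge G → ℕ
    diag A B = 𝟙 ∘ joins (A ∩ B) (∁ (A ∪ B))
    covered : ∀ a → T ((not (lookup X a) ∨ (lookup Y a ∨ lookup Z a)) ∧ (not (lookup Y a) ∨ (lookup X a ∨ lookup Z a))
                       ∧ (not (lookup Z a) ∨ (lookup X a ∨ lookup Y a)))
    covered a rewrite sym (lookup-∪ Y Z a) | sym (lookup-∪ X Z a) | sym (lookup-∪ X Y a) =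
      both (⊆⇒implies X⊆ a) (both (⊆⇒implies Y⊆ a) (⊆⇒implies Z⊆ a))
    at-edge : ∀ e → 𝟙 (crosses G (X ∪ Y ∪ Z) e) ≤ diag X Y e + diag X Z e + diag Y Z e
    at-edge e
      rewrite lookup-∁ (X ∪ Y) (end₁ G e) | lookup-∁ (X ∪ Y) (end₂ G e)
            | lookup-∁ (X ∪ Z) (end₁ G e) | lookup-∁ (X ∪ Z) (end₂ G e)
            | lookup-∁ (Y ∪ Z) (end₁ G e) | lookup-∁ (Y ∪ Z) (end₂ G e)
            | lookup-∩ X Y (end₁ G e) | lookup-∩ X Y (end₂ G e) | lookup-∩ X Z (end₁ G e) | lookup-∩ X Z (end₂ G e)
            | lookup-∩ Y Z (end₁ G e) | lookup-∩ Y Z (end₂ G e)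
            | lookup-∪ X (Y ∪ Z) (end₁ G e) | lookup-∪ X (Y ∪ Z) (end₂ G e)
            | lookup-∪ Y Z (end₁ G e) | lookup-∪ Y Z (end₂ G e)
            | lookup-∪ X Y (end₁ G e) | lookup-∪ X Y (end₂ G e) | lookup-∪ X Z (end₁ G e) | lookup-∪ X Z (end₂ G e)
      = ≤ᵇ⇒≤ _ _ (implied (valid⇒true 6 union₃-table tt
          (lookup X (end₁ G e) ∷ lookup Y (end₁ G e) ∷ lookup Z (end₁ G e)
           ∷ lookup X (end₂ G e) ∷ lookup Y (end₂ G e) ∷ lookup Z (end₂ G e) ∷ []))
          (both (covered (end₁ G e)) (covered (end₂ G e))))

  edgesBetween-s≤∣δ∣ : ∀ s X → s ∉ X → edgesBetween ⁅ s ⁆ X ≤ ∣ δ G X ∣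
  edgesBetween-s≤∣δ∣ s X s∉X = subst (edgesBetween ⁅ s ⁆ X ≤_) (sym (∣δ∣≡sum G X)) (sum-mono-≤ at-edge)
    where
    outside : ∀ a → T (not (lookup ⁅ s ⁆ a) ∨ not (lookup X a))
    outside a rewrite sym (lookup-∁ X a) = ⊆⇒implies (∉⇒⁅⁆⊆∁ s∉X) a
    at-edge : ∀ e → 𝟙 (joins ⁅ s ⁆ X e) ≤ 𝟙 (crosses G X e)
    at-edge e = ≤ᵇ⇒≤ _ _ (implied (valid⇒true 4 s-into-table tt
      (lookup ⁅ s ⁆ (end₁ G e) ∷ lookup X (end₁ G e) ∷ lookup ⁅ s ⁆ (end₂ G e) ∷ lookup X (end₂ G e) ∷ []))
      (both (outside (end₁ G e)) (outside (end₂ G e))))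

-- Lifting

sum-pair : ∀ {m} {g : Fin m → ℕ} {e f} → e ≢ f → (∀ i → i ≢ e → i ≢ f → g i ≡ 0) → sum g ≡ g e + g f
sum-pair {suc m} {g} {e} {f} e≢f g≡0 = begin
  sum g                       ≡⟨ sum-split g e ⟩
  g e + sum (g ∘ punchIn e)   ≡⟨ cong (g e +_) (sum-point (punchOut e≢f) rest≡0) ⟩
  g e + g (punchIn e (punchOut e≢f)) ≡⟨ cong (λ i → g e + g i) (punchIn-punchOut e≢f) ⟩
  g e + g f                   ∎
  where
  open ≡-Reasoning
  rest≡0 : ∀ i → i ≢ punchOut e≢f → g (punchIn e i) ≡ 0
  rest≡0 i i≢ = g≡0 _ (punchInᵢ≢i e i) λ eq →
    i≢ (punchIn-injective e i _ (trans eq (sym (punchIn-punchOut e≢f))))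

sum-lookup : ∀ {A : Set} (w : A → ℕ) (xs : List A) → sum (w ∘ List.lookup xs) ≡ ListAction.sum (List.map w xs)
sum-lookup w []       = refl
sum-lookup w (x ∷ xs) = cong (w x +_) (sum-lookup w xs)

keepWhere-sum : ∀ {A : Set} (xs : List A) p (w : A → ℕ) →
  ListAction.sum (List.map w (keepWhere xs p)) + sum (λ i → if p i then 0 else w (List.lookup xs i))
    ≡ ListAction.sum (List.map w xs)
keepWhere-sum []       p w = refl
keepWhere-sum (x ∷ xs) p w with p zero
... | true  = trans (+-assoc (w x) _ _) (cong (w x +_) (keepWhere-sum xs (p ∘ suc) w))
... | false = begin
  kept + (w x + dropped)  ≡⟨ +-assoc kept (w x) dropped ⟨
  kept + w x + dropped    ≡⟨ cong (_+ dropped) (+-comm kept (w x)) ⟩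
  w x + kept + dropped    ≡⟨ +-assoc (w x) kept dropped ⟩
  w x + (kept + dropped)  ≡⟨ cong (w x +_) (keepWhere-sum xs (p ∘ suc) w) ⟩
  w x + ListAction.sum (List.map w xs) ∎
  where
  open ≡-Reasoning
  kept = ListAction.sum (List.map w (keepWhere xs (p ∘ suc)))
  dropped = sum (λ i → if p (suc i) then 0 else w (List.lookup xs i))

∣δ∣≡listSum : ∀ {n} (H : Graph n) X → ∣ δ H X ∣ ≡ ListAction.sum (List.map (𝟙 ∘ crossesᵖ X) H)
∣δ∣≡listSum H X = trans (∣δ∣≡sum H X) (sum-lookup (𝟙 ∘ crossesᵖ X) H)

∣δ-∷ʳ∣ : ∀ {n} (H : Graph n) p X → ∣ δ (H ++ p ∷ []) X ∣ ≡ ∣ δ H X ∣ + 𝟙 (crossesᵖ X p)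
∣δ-∷ʳ∣ H p X = begin
  ∣ δ (H ++ p ∷ []) X ∣                              ≡⟨ ∣δ∣≡listSum (H ++ p ∷ []) X ⟩
  ListAction.sum (List.map w (H ++ p ∷ []))          ≡⟨ cong ListAction.sum (map-++ w H (p ∷ [])) ⟩
  ListAction.sum (List.map w H ++ List.map w (p ∷ [])) ≡⟨ sum-++ (List.map w H) (List.map w (p ∷ [])) ⟩
  ListAction.sum (List.map w H) + (w p + 0)          ≡⟨ cong₂ _+_ (∣δ∣≡listSum H X) (sym (+-identityʳ (w p))) ⟨
  ∣ δ H X ∣ + w p                                     ∎
  where
  open ≡-Reasoning
  w = 𝟙 ∘ crossesᵖ X

module _ {n} (G : Graph n) where

  deletePair : Edge G → Edge G → Graph n
  deletePair e f = keepWhere G (λ i → not (⌊ i ≟ e ⌋ ∨ ⌊ i ≟ f ⌋))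

  ∣δ-deletePair∣ : ∀ X {e f} → e ≢ f → ∣ δ G X ∣ ≡ ∣ δ (deletePair e f) X ∣ + (𝟙 (crosses G X e) + 𝟙 (crosses G X f))
  ∣δ-deletePair∣ X {e} {f} e≢f = begin
    ∣ δ G X ∣                                    ≡⟨ ∣δ∣≡listSum G X ⟩
    ListAction.sum (List.map w G)                ≡⟨ keepWhere-sum G kept w ⟨
    ListAction.sum (List.map w H) + sum dropped
      ≡⟨ cong₂ _+_ (sym (∣δ∣≡listSum H X)) (sum-pair {g = dropped} e≢f dropped-else) ⟩
    ∣ δ H X ∣ + (dropped e + dropped f)          ≡⟨ cong₂ (λ a b → ∣ δ H X ∣ + (a + b)) dropped-e dropped-f ⟩
    ∣ δ H X ∣ + (𝟙 (crosses G X e) + 𝟙 (crosses G X f)) ∎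
    where
    open ≡-Reasoning
    H = deletePair e f
    w = 𝟙 ∘ crossesᵖ X
    kept : Edge G → Bool
    kept i = not (⌊ i ≟ e ⌋ ∨ ⌊ i ≟ f ⌋)
    dropped : Edge G → ℕ
    dropped i = if kept i then 0 else w (ends G i)
    dropped-e : dropped e ≡ w (ends G e)
    dropped-e with e ≟ e
    ... | yes _   = refl
    ... | no  e≢e = contradiction refl e≢e
    dropped-f : dropped f ≡ w (ends G f)
    dropped-f with f ≟ e | f ≟ f
    ... | yes _ | _       = refl
    ... | no  _ | yes _   = refl
    ... | no  _ | no  f≢f = contradiction refl f≢f
    dropped-else : ∀ i → i ≢ e → i ≢ f → dropped i ≡ 0
    dropped-else i i≢e i≢f with i ≟ e | i ≟ f
    ... | yes i≡e | _       = contradiction i≡e i≢e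
    ... | no  _   | yes i≡f = contradiction i≡f i≢f
    ... | no  _   | no  _   = refl

lift-bits : ∀ a b → 𝟙 a + 𝟙 b ≤ 𝟙 (a xor b) + 2 * 𝟙 (a ∧ b)
lift-bits true  true  = ≤-refl
lift-bits true  false = ≤-refl
lift-bits false true  = ≤-refl
lift-bits false false = ≤-refl

lift-bits-diag : ∀ a → 𝟙 a + 𝟙 a ≤ 2 * 𝟙 (a ∧ a)
lift-bits-diag true  = ≤-refl
lift-bits-diag false = ≤-refl

module _ {n} (G : Graph n) (s : Fin n) where

  crosses-at-s : ∀ X e → IncidentWith G s e → s ∉ X → crosses G X e ≡ lookup X (otherEnd G s e)
  crosses-at-s X e inc s∉X with proj₁ (ends G e) ≟ s | inc
  ... | yes refl | _      rewrite ∉⇒lookup≡false s∉X = refl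
  ... | no  ≢s   | inj₁ ≡s = contradiction ≡s ≢s
  ... | no  _    | inj₂ refl rewrite ∉⇒lookup≡false s∉X = xor-identityʳ _

  ∣δ∣≤∣δ-lift∣ : ∀ X e f → e ≢ f → IncidentWith G s e → IncidentWith G s f → s ∉ X →
    ∣ δ G X ∣ ≤ ∣ δ (lift G s e f) X ∣ + 2 * 𝟙 (lookup X (otherEnd G s e) ∧ lookup X (otherEnd G s f))
  ∣δ∣≤∣δ-lift∣ X e f e≢f inc-e inc-f s∉X = subst (_≤ ∣ δ (lift G s e f) X ∣ + 2 * 𝟙 (xe ∧ xf)) (sym split) after-lift
    where
    xe = lookup X (otherEnd G s e)
    xf = lookup X (otherEnd G s f)
    H = deletePair G e f
    split : ∣ δ G X ∣ ≡ ∣ δ H X ∣ + (𝟙 xe + 𝟙 xf)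
    split = trans (∣δ-deletePair∣ G X e≢f)
      (cong₂ (λ a b → ∣ δ H X ∣ + (𝟙 a + 𝟙 b)) (crosses-at-s X e inc-e s∉X) (crosses-at-s X f inc-f s∉X))
    after-lift : ∣ δ H X ∣ + (𝟙 xe + 𝟙 xf) ≤ ∣ δ (lift G s e f) X ∣ + 2 * 𝟙 (xe ∧ xf)
    after-lift with otherEnd G s e ≟ otherEnd G s f
    ... | yes ve≡vf = begin
      ∣ δ H X ∣ + (𝟙 xe + 𝟙 xf)   ≡⟨ cong (λ v → ∣ δ H X ∣ + (𝟙 xe + 𝟙 (lookup X v))) ve≡vf ⟨
      ∣ δ H X ∣ + (𝟙 xe + 𝟙 xe)   ≤⟨ +-monoʳ-≤ (∣ δ H X ∣) (lift-bits-diag xe) ⟩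
      ∣ δ H X ∣ + 2 * 𝟙 (xe ∧ xe) ≡⟨ cong (λ v → ∣ δ H X ∣ + 2 * 𝟙 (xe ∧ lookup X v)) ve≡vf ⟩
      ∣ δ H X ∣ + 2 * 𝟙 (xe ∧ xf) ∎
      where open ≤-Reasoning
    ... | no _ = begin
      ∣ δ H X ∣ + (𝟙 xe + 𝟙 xf)                    ≤⟨ +-monoʳ-≤ (∣ δ H X ∣) (lift-bits xe xf) ⟩
      ∣ δ H X ∣ + (𝟙 (xe xor xf) + 2 * 𝟙 (xe ∧ xf)) ≡⟨ +-assoc (∣ δ H X ∣) _ _ ⟨
      ∣ δ H X ∣ + 𝟙 (xe xor xf) + 2 * 𝟙 (xe ∧ xf)   ≡⟨ cong (_+ 2 * 𝟙 (xe ∧ xf)) (∣δ-∷ʳ∣ H _ X) ⟨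
      ∣ δ (H ++ (otherEnd G s e , otherEnd G s f) ∷ []) X ∣ + 2 * 𝟙 (xe ∧ xf) ∎
      where open ≤-Reasoning

-- Flows and Menger's theorem

-- A 0/1-flow leaves an edge idle or sends one unit along it forwards or backwards.
data Dir : Set where
  idle fwd bwd : Dir

Flow : ∀ {n} → Graph n → Set
Flow H = Edge H → Dir

point : ∀ {n} → Fin n → Fin n → ℕ
point a z = 𝟙 ⌊ a ≟ z ⌋

tailAt headAt : ∀ {n} → Dir → Fin n × Fin n → Fin n → ℕ
tailAt idle _       z = 0
tailAt fwd  (a , b) z = point a z
tailAt bwd  (a , b) z = point b z
headAt idle _       z = 0
headAt fwd  (a , b) z = point b z
headAt bwd  (a , b) z = point a z

-- Changing the state of an edge with ends p from d to d′ pushes one unit from x to y.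
Pushes : ∀ {n} → Dir → Dir → Fin n × Fin n → Fin n → Fin n → Set
Pushes d d′ p x y = ∀ z → tailAt d′ p z + headAt d p z + point y z ≡ headAt d′ p z + tailAt d p z + point x z

_≟ᵈ_ : DecidableEquality Dir
idle ≟ᵈ idle = yes refl
fwd  ≟ᵈ fwd  = yes refl
bwd  ≟ᵈ bwd  = yes refl
idle ≟ᵈ fwd  = no λ ()
idle ≟ᵈ bwd  = no λ ()
fwd  ≟ᵈ idle = no λ ()
fwd  ≟ᵈ bwd  = no λ ()
bwd  ≟ᵈ idle = no λ ()
bwd  ≟ᵈ fwd  = no λ ()

data Residual {n} (d : Dir) (p : Fin n × Fin n) (x y : Fin n) : Set where
  along   : p ≡ (x , y) → d ≢ fwd → Residual d p x y
  against : p ≡ (y , x) → d ≢ bwd → Residual d p x y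

residual? : ∀ {n} d (p : Fin n × Fin n) x y → Dec (Residual d p x y)
residual? d p x y = map′ to from
  ((≡-dec _≟_ _≟_ p (x , y) ×-dec ¬? (d ≟ᵈ fwd)) ⊎-dec (≡-dec _≟_ _≟_ p (y , x) ×-dec ¬? (d ≟ᵈ bwd)))
  where
  to : _ → Residual d p x y
  to (inj₁ (p≡ , d≢)) = along p≡ d≢
  to (inj₂ (p≡ , d≢)) = against p≡ d≢
  from : Residual d p x y → _
  from (along p≡ d≢)   = inj₁ (p≡ , d≢)
  from (against p≡ d≢) = inj₂ (p≡ , d≢)

push : ∀ {n} {d : Dir} {p : Fin n × Fin n} {x y} → Residual d p x y → Dir
push {d = idle} (along _ _)   = fwd
push {d = fwd}  (along _ d≢)  = ⊥-elim (d≢ refl)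
push {d = bwd}  (along _ _)   = idle
push {d = idle} (against _ _) = bwd
push {d = fwd}  (against _ _) = idle
push {d = bwd}  (against _ d≢) = ⊥-elim (d≢ refl)

swap-around-0 : ∀ a b → a + 0 + b ≡ b + 0 + a
swap-around-0 a b = solve 2 (λ a b → a :+ con 0 :+ b := b :+ con 0 :+ a) refl a b

push-pushes : ∀ {n} {d : Dir} {p : Fin n × Fin n} {x y} (r : Residual d p x y) → Pushes d (push r) p x y
push-pushes {d = idle} {x = x} {y} (along refl _)   z = swap-around-0 (point x z) (point y z)
push-pushes {d = fwd}             (along refl d≢)  z = ⊥-elim (d≢ refl)
push-pushes {d = bwd}  {x = x} {y} (along refl _)   z = +-comm (point x z) (point y z)
push-pushes {d = idle} {x = x} {y} (against refl _) z = swap-around-0 (point x z) (point y z)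
push-pushes {d = fwd}  {x = x} {y} (against refl _) z = +-comm (point x z) (point y z)
push-pushes {d = bwd}             (against refl d≢) z = ⊥-elim (d≢ refl)

module _ {n} (H : Graph n) where

  outflow inflow : Flow H → Fin n → ℕ
  outflow f z = sum λ e → tailAt (f e) (ends H e) z
  inflow  f z = sum λ e → headAt (f e) (ends H e) z

  -- f has supply p and demand q: at every vertex, outflow − inflow = p − q.
  Balanced : Flow H → (Fin n → ℕ) → (Fin n → ℕ) → Set
  Balanced f p q = ∀ z → outflow f z + q z ≡ inflow f z + p z

  balanced-cong : ∀ {f : Flow H} {p q p′ q′ : Fin n → ℕ} → (∀ z → p z ≡ p′ z) → (∀ z → q z ≡ q′ z) →
    Balanced f p q → Balanced f p′ q′
  balanced-cong p≡ q≡ bal z rewrite sym (p≡ z) | sym (q≡ z) = bal z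

  balanced-cancel : ∀ {f : Flow H} {p q : Fin n → ℕ} (r : Fin n → ℕ) →
    Balanced f (λ z → p z + r z) (λ z → q z + r z) → Balanced f p q
  balanced-cancel {f} {p} {q} r bal z = +-cancelʳ-≡ (r z) _ _ (begin
    outflow f z + q z + r z   ≡⟨ +-assoc (outflow f z) (q z) (r z) ⟩
    outflow f z + (q z + r z) ≡⟨ bal z ⟩
    inflow f z + (p z + r z)  ≡⟨ +-assoc (inflow f z) (p z) (r z) ⟨
    inflow f z + p z + r z    ∎)
    where open ≡-Reasoning

  balanced-add : ∀ {f : Flow H} {p q : Fin n → ℕ} (r : Fin n → ℕ) →
    Balanced f p q → Balanced f (λ z → p z + r z) (λ z → q z + r z)
  balanced-add {f} {p} {q} r bal z = begin
    outflow f z + (q z + r z) ≡⟨ +-assoc (outflow f z) (q z) (r z) ⟨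
    outflow f z + q z + r z   ≡⟨ cong (_+ r z) (bal z) ⟩
    inflow f z + p z + r z    ≡⟨ +-assoc (inflow f z) (p z) (r z) ⟩
    inflow f z + (p z + r z)  ∎
    where open ≡-Reasoning

  balanced-update : ∀ {f : Flow H} {p q : Fin n → ℕ} e d′ {x y} → Pushes (f e) d′ (ends H e) x y →
    Balanced f p q → Balanced (updateAt f e (const d′)) (λ z → p z + point x z) (λ z → q z + point y z)
  balanced-update {f} {p} {q} e d′ {x} {y} pushes bal z =
    +-cancelʳ-≡ (t + h) (O′ + (q z + point y z)) (I′ + (p z + point x z)) (begin
      O′ + (q z + point y z) + (t + h)
        ≡⟨ solve 6 (λ a b c d e′ f′ → a :+ (b :+ c) :+ (d :+ e′) := (a :+ d) :+ b :+ (e′ :+ c)) refl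
                   O′ (q z) (point y z) t h h ⟩
      (O′ + t) + q z + (h + point y z)
        ≡⟨ cong (λ o → o + q z + (h + point y z)) out-changes ⟩
      (O + t′) + q z + (h + point y z)
        ≡⟨ solve 5 (λ a b c d e′ → (a :+ b) :+ c :+ (d :+ e′) := (a :+ c) :+ (b :+ d :+ e′)) refl
                   O t′ (q z) h (point y z) ⟩
      (O + q z) + (t′ + h + point y z)
        ≡⟨ cong₂ _+_ (bal z) (pushes z) ⟩
      (I + p z) + (h′ + t + point x z)
        ≡⟨ solve 5 (λ a b c d e′ → (a :+ b) :+ (c :+ d :+ e′) := (a :+ c) :+ b :+ (d :+ e′)) refl
                   I (p z) h′ t (point x z) ⟩
      (I + h′) + p z + (t + point x z)
        ≡⟨ cong (λ i → i + p z + (t + point x z)) in-changes ⟨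
      (I′ + h) + p z + (t + point x z)
        ≡⟨ solve 5 (λ a b c d e′ → (a :+ b) :+ c :+ (d :+ e′) := a :+ (c :+ e′) :+ (d :+ b)) refl
                   I′ h (p z) t (point x z) ⟩
      I′ + (p z + point x z) + (t + h) ∎)
    where
    open ≡-Reasoning
    f′ = updateAt f e (const d′)
    O = outflow f z
    O′ = outflow f′ z
    I = inflow f z
    I′ = inflow f′ z
    t = tailAt (f e) (ends H e) z
    h = headAt (f e) (ends H e) z
    t′ = tailAt d′ (ends H e) z
    h′ = headAt d′ (ends H e) z
    unchanged : ∀ i → i ≢ e → f′ i ≡ f i
    unchanged i i≢e = updateAt-minimal i e f i≢e
    out-changes : O′ + t ≡ O + t′
    out-changes = trans (sum-update e (λ i i≢e → cong (λ d → tailAt d (ends H i) z) (unchanged i i≢e)))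
                        (cong (λ d → O + tailAt d (ends H e) z) (updateAt-updates e f))
    in-changes : I′ + h ≡ I + h′
    in-changes = trans (sum-update e (λ i i≢e → cong (λ d → headAt d (ends H i) z) (unchanged i i≢e)))
                       (cong (λ d → I + headAt d (ends H e) z) (updateAt-updates e f))

  Inside : Subset n → Edge H → Set
  Inside R e = proj₁ (ends H e) ∈ R × proj₂ (ends H e) ∈ R

  residual-inside : ∀ {d e x y} {R : Subset n} → Residual d (ends H e) x y → x ∈ R → y ∈ R → Inside R e
  residual-inside (along p≡ _)   x∈R y∈R rewrite p≡ = x∈R , y∈R
  residual-inside (against p≡ _) x∈R y∈R rewrite p≡ = y∈R , x∈R

  residual-outside : ∀ {d e x y} {R : Subset n} → Residual d (ends H e) x y → y ∉ R → ¬ Inside R e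
  residual-outside (along p≡ _)   y∉R inside rewrite p≡ = y∉R (proj₂ inside)
  residual-outside (against p≡ _) y∉R inside rewrite p≡ = y∉R (proj₁ inside)

  Closed : Flow H → Subset n → Set
  Closed f R = ∀ {x y} e → x ∈ R → Residual (f e) (ends H e) x y → y ∈ R

  module _ (f : Flow H) (p q : Fin n → ℕ) (bal : Balanced f p q) (u v : Fin n) where

    -- g arises from f by pushing a unit from u to y through edges inside R.
    Augmentation : Subset n → Fin n → Set
    Augmentation R y = Σ (Flow H) λ g → Balanced g (λ z → p z + point u z) (λ z → q z + point y z)
                                        × (∀ e → ¬ Inside R e → g e ≡ f e)

    extend-augmentation : ∀ {R x y} e → (∀ z → z ∈ R → Augmentation R z) → x ∈ R → y ∉ R →
      Residual (f e) (ends H e) x y → ∀ z → z ∈ R ∪ ⁅ y ⁆ → Augmentation (R ∪ ⁅ y ⁆) z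
    extend-augmentation {R} {x} {y} e aug x∈R y∉R r z z∈R′ with x∈p∪q⁻ R ⁅ y ⁆ z∈R′
    ... | inj₁ z∈R = let (g , bal-g , agree) = aug z z∈R in
                     g , bal-g , λ e′ outside → agree e′ (λ inside → outside (grow inside))
      where
      grow : ∀ {e′} → Inside R e′ → Inside (R ∪ ⁅ y ⁆) e′
      grow (i₁ , i₂) = p⊆p∪q ⁅ y ⁆ i₁ , p⊆p∪q ⁅ y ⁆ i₂
    ... | inj₂ z∈⁅y⁆ rewrite x∈⁅y⁆⇒x≡y y z∈⁅y⁆ = g′ , bal′ , agree′
      where
      g = proj₁ (aug x x∈R)
      ge≡fe : g e ≡ f e
      ge≡fe = proj₂ (proj₂ (aug x x∈R)) e (residual-outside r y∉R)
      r′ : Residual (g e) (ends H e) x y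
      r′ = subst (λ d → Residual d (ends H e) x y) (sym ge≡fe) r
      g′ = updateAt g e (const (push r′))
      bal′ : Balanced g′ (λ z → p z + point u z) (λ z → q z + point y z)
      bal′ = balanced-cancel {f = g′} (point x)
               (balanced-cong {f = g′} (λ _ → refl) (λ z → xy∙z≈xz∙y (q z) (point x z) (point y z))
                 (balanced-update {f = g} e (push r′) (push-pushes r′) (proj₁ (proj₂ (aug x x∈R)))))
      e-inside : Inside (R ∪ ⁅ y ⁆) e
      e-inside = residual-inside r (p⊆p∪q ⁅ y ⁆ x∈R) (q⊆p∪q R ⁅ y ⁆ (x∈⁅x⁆ y))
      agree′ : ∀ e′ → ¬ Inside (R ∪ ⁅ y ⁆) e′ → g′ e′ ≡ f e′
      agree′ e′ outside with e′ ≟ e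
      ... | yes refl = contradiction e-inside outside
      ... | no e′≢e  = trans (updateAt-minimal e′ e g e′≢e)
                             (proj₂ (proj₂ (aug x x∈R)) e′ λ (i₁ , i₂) → outside (p⊆p∪q ⁅ y ⁆ i₁ , p⊆p∪q ⁅ y ⁆ i₂))

    AugmentOrCut : Set
    AugmentOrCut = (Σ (Flow H) λ g → Balanced g (λ z → p z + point u z) (λ z → q z + point v z))
                 ⊎ (Σ (Subset n) λ R → u ∈ R × v ∉ R × Closed f R)

    augment-or-cut : AugmentOrCut
    augment-or-cut = search ⁅ u ⁆ (⊃-wellFounded _) (x∈⁅x⁆ u) start
      where
      start : ∀ z → z ∈ ⁅ u ⁆ → Augmentation ⁅ u ⁆ z
      start z z∈⁅u⁆ rewrite x∈⁅y⁆⇒x≡y u z∈⁅u⁆ = f , balanced-add {f = f} (point u) bal , λ _ _ → refl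
      search : ∀ R → Acc _⊃_ R → u ∈ R → (∀ z → z ∈ R → Augmentation R z) → AugmentOrCut
      search R (acc larger) u∈R aug with v ∈? R
      ... | yes v∈R = inj₁ (proj₁ (aug v v∈R) , proj₁ (proj₂ (aug v v∈R)))
      ... | no  v∉R
        with any? (λ x → any? λ y → any? λ e → x ∈? R ×-dec (¬? (y ∈? R) ×-dec residual? (f e) (ends H e) x y))
      ...   | no  stuck = inj₂ (R , u∈R , v∉R , closed)
        where
        closed : Closed f R
        closed {x} {y} e x∈R r with y ∈? R
        ... | yes y∈R = y∈R
        ... | no  y∉R = contradiction (x , y , e , x∈R , y∉R , r) stuck
      ...   | yes (x , y , e , x∈R , y∉R , r) =
              search (R ∪ ⁅ y ⁆) (larger (p⊆p∪q ⁅ y ⁆ , y , q⊆p∪q R ⁅ y ⁆ (x∈⁅x⁆ y) , y∉R))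
                     (p⊆p∪q ⁅ y ⁆ u∈R) (extend-augmentation e aug x∈R y∉R r)

  FlowOf : ℕ → Fin n → Fin n → Flow H → Set
  FlowOf j u v f = Balanced f (λ z → j * point u z) (λ z → j * point v z)

point-self : ∀ {n} (a : Fin n) → point a a ≡ 1
point-self a with a ≟ a
... | yes _   = refl
... | no  a≢a = contradiction refl a≢a

point-other : ∀ {n} {a z : Fin n} → z ≢ a → point a z ≡ 0
point-other {a = a} {z} z≢a with a ≟ z
... | yes a≡z = contradiction (sym a≡z) z≢a
... | no  _   = refl

weighted-point : ∀ {n} (g : Fin n → ℕ) a → sum (λ z → g z * point a z) ≡ g a
weighted-point g a = begin
  sum (λ z → g z * point a z) ≡⟨ sum-point a (λ z z≢a → trans (cong (g z *_) (point-other z≢a)) (*-zeroʳ (g z))) ⟩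
  g a * point a a             ≡⟨ cong (g a *_) (point-self a) ⟩
  g a * 1                     ≡⟨ *-identityʳ (g a) ⟩
  g a                         ∎
  where open ≡-Reasoning

tailBit headBit : Dir → Bool → Bool → ℕ
tailBit idle _  _  = 0
tailBit fwd  ra rb = 𝟙 ra
tailBit bwd  ra rb = 𝟙 rb
headBit idle _  _  = 0
headBit fwd  ra rb = 𝟙 rb
headBit bwd  ra rb = 𝟙 ra

module _ {n} (R : Subset n) where

  inR : Fin n → ℕ
  inR z = 𝟙 (lookup R z)

  weigh : (Fin n → ℕ) → ℕ
  weigh g = sum λ z → inR z * g z

  weigh-point : ∀ j a → weigh (λ z → j * point a z) ≡ inR a * j
  weigh-point j a = trans (sum-cong-≗ λ z → sym (*-assoc (inR z) j (point a z))) (weighted-point (λ z → inR z * j) a)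

  tailAt-in : ∀ d (a b : Fin n) → sum (λ z → inR z * tailAt d (a , b) z) ≡ tailBit d (lookup R a) (lookup R b)
  tailAt-in idle a b = sum-zero (λ z → *-zeroʳ (inR z))
  tailAt-in fwd  a b = weighted-point inR a
  tailAt-in bwd  a b = weighted-point inR b

  headAt-in : ∀ d (a b : Fin n) → sum (λ z → inR z * headAt d (a , b) z) ≡ headBit d (lookup R a) (lookup R b)
  headAt-in idle a b = sum-zero (λ z → *-zeroʳ (inR z))
  headAt-in fwd  a b = weighted-point inR b
  headAt-in bwd  a b = weighted-point inR a

closed-edge : ∀ {n} d (a b : Fin n) ra rb →
  (Residual d (a , b) a b → ra ≡ true → rb ≡ true) → (Residual d (a , b) b a → rb ≡ true → ra ≡ true) →
  𝟙 (ra xor rb) + headBit d ra rb ≤ tailBit d ra rb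
closed-edge d    a b true  true  _ _ with d
... | idle = z≤n
... | fwd  = ≤-refl
... | bwd  = ≤-refl
closed-edge d    a b false false _ _ with d
... | idle = z≤n
... | fwd  = z≤n
... | bwd  = z≤n
closed-edge idle a b true  false ab _ = contradiction (ab (along refl λ ()) refl) λ ()
closed-edge fwd  a b true  false _  _ = ≤-refl
closed-edge bwd  a b true  false ab _ = contradiction (ab (along refl λ ()) refl) λ ()
closed-edge idle a b false true  _ ba = contradiction (ba (against refl λ ()) refl) λ ()
closed-edge fwd  a b false true  _ ba = contradiction (ba (against refl λ ()) refl) λ ()
closed-edge bwd  a b false true  _ _  = ≤-refl

module _ {n} (H : Graph n) where

  unitsFrom unitsInto : Subset n → Flow H → ℕ
  unitsFrom R f = sum λ e → tailBit (f e) (lookup R (end₁ H e)) (lookup R (end₂ H e))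
  unitsInto R f = sum λ e → headBit (f e) (lookup R (end₁ H e)) (lookup R (end₂ H e))

  weigh-edges : ∀ R (f : Flow H) (c : Dir → Fin n × Fin n → Fin n → ℕ) →
    weigh R (λ z → sum λ e → c (f e) (ends H e) z) ≡ sum (λ e → sum λ z → inR R z * c (f e) (ends H e) z)
  weigh-edges R f c = trans (sum-cong-≗ λ z → *-distribˡ-sum (inR R z) (λ e → c (f e) (ends H e) z))
                            (∑-comm (λ z e → inR R z * c (f e) (ends H e) z))

  balance-over : ∀ R {f : Flow H} {p q} → Balanced H f p q → unitsFrom R f + weigh R q ≡ unitsInto R f + weigh R p
  balance-over R {f} {p} {q} bal = begin
    unitsFrom R f + weigh R q                ≡⟨ cong (_+ weigh R q) weigh-out ⟨
    weigh R (outflow H f) + weigh R q        ≡⟨ ∑-distrib-+ (λ z → inR R z * outflow H f z) (λ z → inR R z * q z) ⟨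
    sum (λ z → inR R z * outflow H f z + inR R z * q z)
                                             ≡⟨ sum-cong-≗ (λ z → *-distribˡ-+ (inR R z) (outflow H f z) (q z)) ⟨
    weigh R (λ z → outflow H f z + q z)      ≡⟨ sum-cong-≗ (λ z → cong (inR R z *_) (bal z)) ⟩
    weigh R (λ z → inflow H f z + p z)       ≡⟨ sum-cong-≗ (λ z → *-distribˡ-+ (inR R z) (inflow H f z) (p z)) ⟩
    sum (λ z → inR R z * inflow H f z + inR R z * p z)
                                             ≡⟨ ∑-distrib-+ (λ z → inR R z * inflow H f z) (λ z → inR R z * p z) ⟩
    weigh R (inflow H f) + weigh R p         ≡⟨ cong (_+ weigh R p) weigh-in ⟩
    unitsInto R f + weigh R p                ∎
    where
    open ≡-Reasoning
    weigh-out : weigh R (outflow H f) ≡ unitsFrom R f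
    weigh-out = trans (weigh-edges R f tailAt) (sum-cong-≗ λ e → tailAt-in R (f e) (end₁ H e) (end₂ H e))
    weigh-in : weigh R (inflow H f) ≡ unitsInto R f
    weigh-in = trans (weigh-edges R f headAt) (sum-cong-≗ λ e → headAt-in R (f e) (end₁ H e) (end₂ H e))

  -- Every edge leaving a closed set carries a unit out of it.
  closed⇒cut-saturated : ∀ {f R} → Closed H f R → ∣ δ H R ∣ + unitsInto R f ≤ unitsFrom R f
  closed⇒cut-saturated {f} {R} closed = begin
    ∣ δ H R ∣ + unitsInto R f                ≡⟨ cong (_+ unitsInto R f) (∣δ∣≡sum H R) ⟩
    sum (𝟙 ∘ crosses H R) + unitsInto R f    ≡⟨ ∑-distrib-+ (𝟙 ∘ crosses H R) _ ⟨
    sum (λ e → 𝟙 (crosses H R e) + _)        ≤⟨ sum-mono-≤ at-edge ⟩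
    unitsFrom R f                            ∎
    where
    open ≤-Reasoning
    at-edge : ∀ e → 𝟙 (crosses H R e) + headBit (f e) (lookup R (end₁ H e)) (lookup R (end₂ H e))
                    ≤ tailBit (f e) (lookup R (end₁ H e)) (lookup R (end₂ H e))
    at-edge e with ends H e in ends≡
    ... | (a , b) = closed-edge (f e) a b (lookup R a) (lookup R b)
      (λ r ra → []=⇒lookup (closed e (lookup⇒[]= a R ra) (subst (λ p → Residual (f e) p a b) (sym ends≡) r)))
      (λ r rb → []=⇒lookup (closed e (lookup⇒[]= b R rb) (subst (λ p → Residual (f e) p b a) (sym ends≡) r)))

  closed-cut≤value : ∀ {j u v f R} → FlowOf H j u v f → Closed H f R → u ∈ R → v ∉ R → ∣ δ H R ∣ ≤ j
  closed-cut≤value {j} {u} {v} {f} {R} bal closed u∈R v∉R =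
    +-cancelʳ-≤ (unitsInto R f) ∣ δ H R ∣ j (begin
      ∣ δ H R ∣ + unitsInto R f                   ≤⟨ closed⇒cut-saturated {f = f} closed ⟩
      unitsFrom R f                               ≡⟨ +-identityʳ _ ⟨
      unitsFrom R f + 0                           ≡⟨ cong (unitsFrom R f +_) demand-outside ⟨
      unitsFrom R f + weigh R (λ z → j * point v z) ≡⟨ balance-over R {f = f} bal ⟩
      unitsInto R f + weigh R (λ z → j * point u z) ≡⟨ cong (unitsInto R f +_) supply-inside ⟩
      unitsInto R f + j                           ≡⟨ +-comm (unitsInto R f) j ⟩
      j + unitsInto R f                           ∎)
    where
    open ≤-Reasoning
    demand-outside : weigh R (λ z → j * point v z) ≡ 0
    demand-outside = trans (weigh-point R j v) (cong (λ b → 𝟙 b * j) (∉⇒lookup≡false v∉R))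
    supply-inside : weigh R (λ z → j * point u z) ≡ j
    supply-inside = trans (weigh-point R j u) (trans (cong (λ b → 𝟙 b * j) ([]=⇒lookup u∈R)) (*-identityˡ j))

  flow-of-value : ∀ k u v → (∀ X → u ∈ X → v ∉ X → k ≤ ∣ δ H X ∣) → Σ (Flow H) (FlowOf H k u v)
  flow-of-value k u v cuts = flow-up k ≤-refl
    where
    flow-up : ∀ j → j ≤ k → Σ (Flow H) (FlowOf H j u v)
    flow-up zero    _   = (λ _ → idle) , λ _ → refl
    flow-up (suc j) j<k with flow-up j (≤-trans (n≤1+n j) j<k)
    ... | f , bal with augment-or-cut H f (λ z → j * point u z) (λ z → j * point v z) bal u v
    ...   | inj₁ (g , bal-g) = g , balanced-cong H {f = g} (λ z → +-comm (j * point u z) (point u z))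
                                                          (λ z → +-comm (j * point v z) (point v z)) bal-g
    ...   | inj₂ (R , u∈R , v∉R , closed) =
            contradiction (≤-trans (cuts R u∈R v∉R) (closed-cut≤value bal closed u∈R v∉R)) (<⇒≱ j<k)

Carries : ∀ {n} → Dir → Fin n × Fin n → Fin n → Fin n → Set
Carries d p a b = (d ≡ fwd × p ≡ (a , b)) ⊎ (d ≡ bwd × p ≡ (b , a))

carries-from-tail : ∀ {n} d (p : Fin n × Fin n) a → 0 < tailAt d p a → ∃ λ b → Carries d p a b
carries-from-tail fwd (a′ , b) a pos with a′ ≟ a
... | yes refl = b , inj₁ (refl , refl)
carries-from-tail fwd (a′ , b) a () | no _
carries-from-tail bwd (b , a′) a pos with a′ ≟ a
... | yes refl = b , inj₂ (refl , refl)
carries-from-tail bwd (b , a′) a () | no _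

carries-pushes : ∀ {n} {d} {p : Fin n × Fin n} {a b} → Carries d p a b → Pushes d idle p b a
carries-pushes {a = a} {b} (inj₁ (refl , refl)) = push-pushes {d = fwd} {x = b} {y = a} (against refl λ ())
carries-pushes {a = a} {b} (inj₂ (refl , refl)) = push-pushes {d = bwd} {x = b} {y = a} (along refl λ ())

carries-busy : ∀ {n} {d} {p : Fin n × Fin n} {a b} → Carries d p a b → d ≢ idle
carries-busy (inj₁ (refl , _)) ()
carries-busy (inj₂ (refl , _)) ()

isBusy : Dir → Bool
isBusy idle = false
isBusy fwd  = true
isBusy bwd  = true

isBusy-≢idle : ∀ d → d ≢ idle → 𝟙 (isBusy d) ≡ 1
isBusy-≢idle idle d≢ = contradiction refl d≢
isBusy-≢idle fwd  _  = refl
isBusy-≢idle bwd  _  = refl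

module _ {n} (H : Graph n) where

  busy : Flow H → ℕ
  busy f = sum λ e → 𝟙 (isBusy (f e))

  carries-traverses : ∀ {f : Flow H} {e a b} → Carries (f e) (ends H e) a b → Traverses H e a b
  carries-traverses (inj₁ (_ , p≡)) = inj₁ p≡
  carries-traverses (inj₂ (_ , p≡)) = inj₂ p≡

  -- A walk from a to v along busy edges of f, and what is left of f after idling it.
  record Peeling (f : Flow H) (a v : Fin n) (P Q : Fin n → ℕ) : Set where
    field
      walk     : Walk H a v
      rest     : Flow H
      balanced : Balanced H rest P Q
      used     : ∀ e → e ∈ₗ walkEdges walk → f e ≢ idle × rest e ≡ idle
      smaller  : ∀ e → rest e ≢ idle → f e ≢ idle

  outflow-pos : ∀ {f : Flow H} {P Q : Fin n → ℕ} {a v} → a ≢ v → Q a ≡ 0 →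
    Balanced H f (λ z → P z + point a z) (λ z → Q z + point v z) → 0 < outflow H f a
  outflow-pos {f} {P} {Q} {a} {v} a≢v Qa≡0 bal = begin-strict
    0                                         <⟨ s≤s z≤n ⟩
    1                                         ≤⟨ m≤n+m 1 (inflow H f a + P a) ⟩
    inflow H f a + P a + 1                    ≡⟨ +-assoc (inflow H f a) (P a) 1 ⟩
    inflow H f a + (P a + 1)                  ≡⟨ cong (λ x → inflow H f a + (P a + x)) (point-self a) ⟨
    inflow H f a + (P a + point a a)          ≡⟨ bal a ⟨
    outflow H f a + (Q a + point v a)         ≡⟨ cong₂ (λ x y → outflow H f a + (x + y)) Qa≡0 (point-other a≢v) ⟩
    outflow H f a + 0                         ≡⟨ +-identityʳ _ ⟩
    outflow H f a                             ∎
    where open ≤-Reasoning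

  busy-idle< : ∀ (f : Flow H) e → f e ≢ idle → busy (updateAt f e (const idle)) < busy f
  busy-idle< f e fe≢idle = begin-strict
    busy f₁                           <⟨ m<m+n (busy f₁) (s≤s z≤n) ⟩
    busy f₁ + 1                       ≡⟨ cong (busy f₁ +_) (isBusy-≢idle (f e) fe≢idle) ⟨
    busy f₁ + 𝟙 (isBusy (f e))        ≡⟨ sum-update e (λ i i≢e → cong (𝟙 ∘ isBusy) (updateAt-minimal i e f i≢e)) ⟩
    busy f + 𝟙 (isBusy (f₁ e))        ≡⟨ cong (λ d → busy f + 𝟙 (isBusy d)) (updateAt-updates e f) ⟩
    busy f + 0                        ≡⟨ +-identityʳ _ ⟩
    busy f                            ∎
    where
    open ≤-Reasoning
    f₁ = updateAt f e (const idle)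

  balanced-idle : ∀ {f : Flow H} {P Q : Fin n → ℕ} {e a b} → Carries (f e) (ends H e) a b →
    Balanced H f (λ z → P z + point a z) Q → Balanced H (updateAt f e (const idle)) (λ z → P z + point b z) Q
  balanced-idle {f} {P} {Q} {e} {a} {b} carries bal = balanced-cancel H {f = f₁} (point a)
    (balanced-cong H {f = f₁} (λ z → xy∙z≈xz∙y (P z) (point a z) (point b z)) (λ _ → refl)
      (balanced-update H {f = f} e idle (carries-pushes carries) bal))
    where f₁ = updateAt f e (const idle)

  -- Follow the flow out of a, idling each edge taken, until the sink v is reached.
  peel : ∀ {P Q v} → (∀ z → z ≢ v → Q z ≡ 0) → ∀ f a → Acc _<_ (busy f) →
    Balanced H f (λ z → P z + point a z) (λ z → Q z + point v z) → Peeling f a v P Q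
  peel {P} {Q} {v} Q≡0 f a (acc smaller-busy) bal with a ≟ v
  ... | yes refl = record
    { walk = [] ; rest = f ; balanced = balanced-cancel H {f = f} (point a) bal
    ; used = λ _ () ; smaller = λ _ busy → busy }
  ... | no a≢v with sum-pos⇒∃ _ (outflow-pos {f = f} a≢v (Q≡0 a a≢v) bal)
  ... | e , pos with carries-from-tail (f e) (ends H e) a pos
  ... | b , carries = record
    { walk = step e (carries-traverses {f = f} carries) walk
    ; rest = rest
    ; balanced = balanced
    ; used = λ { _ (here refl) → carries-busy carries , rest-idle-at-e
               ; e′ (there e′∈) → f₁⊑f e′ (proj₁ (used e′ e′∈)) , proj₂ (used e′ e′∈) }
    ; smaller = λ e′ → f₁⊑f e′ ∘ smaller e′ }
    where
    f₁ = updateAt f e (const idle)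
    f₁⊑f : ∀ e′ → f₁ e′ ≢ idle → f e′ ≢ idle
    f₁⊑f e′ busy with e′ ≟ e
    ... | yes refl = carries-busy carries
    ... | no e′≢e  = busy ∘ trans (updateAt-minimal e′ e f e′≢e)
    open Peeling (peel Q≡0 f₁ b (smaller-busy (busy-idle< f e (carries-busy carries)))
                   (balanced-idle {f = f} carries bal))
    rest-idle-at-e : rest e ≡ idle
    rest-idle-at-e with rest e ≟ᵈ idle
    ... | yes r≡idle = r≡idle
    ... | no  r≢idle = contradiction (updateAt-updates e f) (smaller e r≢idle)

  decompose : ∀ {u v} j f → FlowOf H j u v f →
    Σ (Fin j → Walk H u v) λ W → (∀ i e → e ∈ₗ walkEdges (W i) → f e ≢ idle)
                               × (∀ i i′ → i ≢ i′ → Disjoint (walkEdges (W i)) (walkEdges (W i′)))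
  decompose         zero    f bal = (λ ()) , (λ ()) , (λ ())
  decompose {u} {v} (suc j) f bal = W , busy-on-W , disjoint
    where
    Q≡0 : ∀ z → z ≢ v → j * point v z ≡ 0
    Q≡0 z z≢v = trans (cong (j *_) (point-other z≢v)) (*-zeroʳ j)
    first : Peeling f u v (λ z → j * point u z) (λ z → j * point v z)
    first = peel Q≡0 f u (<-wellFounded (busy f))
              (balanced-cong H {f = f} (λ z → +-comm (point u z) (j * point u z))
                                       (λ z → +-comm (point v z) (j * point v z)) bal)
    open Peeling first
    others = decompose j rest balanced
    W : Fin (suc j) → Walk H u v
    W zero    = walk
    W (suc i) = proj₁ others i
    busy-on-W : ∀ i e → e ∈ₗ walkEdges (W i) → f e ≢ idle
    busy-on-W zero    e e∈ = proj₁ (used e e∈)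
    busy-on-W (suc i) e e∈ = smaller e (proj₁ (proj₂ others) i e e∈)
    disjoint : ∀ i i′ → i ≢ i′ → Disjoint (walkEdges (W i)) (walkEdges (W i′))
    disjoint zero    zero     0≢0 _           = 0≢0 refl
    disjoint zero    (suc i′) _   (e∈ , e∈′) = proj₁ (proj₂ others) i′ _ e∈′ (proj₂ (used _ e∈))
    disjoint (suc i) zero     _   (e∈ , e∈′) = proj₁ (proj₂ others) i _ e∈ (proj₂ (used _ e∈′))
    disjoint (suc i) (suc i′) i≢i′          = proj₂ (proj₂ others) i i′ (i≢i′ ∘ cong suc)

  path-suffix : ∀ {w b} (P : Walk H w b) → IsPath P → ∀ a → a ∈ₗ walkVertices P →
    Σ (Path H a b) λ P′ → ∀ e → e ∈ₗ walkEdges (proj₁ P′) → e ∈ₗ walkEdges P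
  path-suffix []           unique _ (here refl) = ([] , unique) , λ _ ()
  path-suffix (step e t P) unique _ (here refl) = (step e t P , unique) , λ _ e∈ → e∈
  path-suffix (step e t P) (_ ∷ unique) a (there a∈) =
    let (P′ , sub) = path-suffix P unique a a∈ in P′ , λ e′ e′∈ → there (sub e′ e′∈)

  walk⇒path : ∀ {a b} (W : Walk H a b) → Σ (Path H a b) λ P → ∀ e → e ∈ₗ walkEdges (proj₁ P) → e ∈ₗ walkEdges W
  walk⇒path []           = ([] , ([] ∷ [])) , λ _ ()
  walk⇒path {a} (step e t W) with walk⇒path W
  ... | (P , unique) , sub with Any.any? (a ≟_) (walkVertices P)
  ...   | yes a∈P = let (P′ , sub′) = path-suffix P unique a a∈P in P′ , λ e′ e′∈ → there (sub e′ (sub′ e′ e′∈))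
  ...   | no  a∉P = (step e t P , (¬Any⇒All¬ _ a∉P ∷ unique)) ,
                    λ { _ (here refl) → here refl ; e′ (there e′∈) → there (sub e′ e′∈) }

  menger : ∀ k u v → (∀ X → u ∈ X → v ∉ X → k ≤ ∣ δ H X ∣) → EdgeDisjointPaths H k u v
  menger k u v cuts = P , λ i i′ i≢i′ (e∈ , e∈′) →
    disjoint i i′ i≢i′ (proj₂ (walk⇒path (W i)) _ e∈ , proj₂ (walk⇒path (W i′)) _ e∈′)
    where
    flow = flow-of-value H k u v cuts
    walks = decompose k (proj₁ flow) (proj₂ flow)
    W = proj₁ walks
    disjoint = proj₂ (proj₂ walks)
    P : Fin k → Path H u v
    P i = proj₁ (walk⇒path (W i))

module _ {n} (H : Graph n) (s : Fin n) (k : ℕ) where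

  -- Menger's theorem, with the cut complemented if it contains s.
  ¬connected⇒small-cut : 3 ≤ n → 1 ≤ k → ¬ SKEdgeConnected H s k →
    ∃ λ X → s ∉ X × Nonempty X × (∃ λ b → b ∉ X × b ≢ s) × ∣ δ H X ∣ < k
  ¬connected⇒small-cut 3≤n 1≤k ¬conn
    with any? (λ u → any? λ v → anySubset? λ X →
           ¬? (u ≟ s) ×-dec (¬? (v ≟ s) ×-dec (u ∈? X ×-dec (¬? (v ∈? X) ×-dec (∣ δ H X ∣ <? k)))))
  ... | no no-small-cut = contradiction (3≤n , 1≤k , paths) ¬conn
    where
    paths : ∀ u v → u ≢ s → v ≢ s → u ≢ v → EdgeDisjointPaths H k u v
    paths u v u≢s v≢s _ = menger H k u v λ X u∈X v∉X →
      ≮⇒≥ λ small → no-small-cut (u , v , X , u≢s , v≢s , u∈X , v∉X , small)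
  ... | yes (u , v , X , u≢s , v≢s , u∈X , v∉X , small) with s ∈? X
  ...   | no  s∉X = X , s∉X , (u , u∈X) , (v , v∉X , v≢s) , small
  ...   | yes s∈X = ∁ X , x∈p⇒x∉∁p s∈X , (v , x∉p⇒x∈∁p v∉X) , (u , x∈p⇒x∉∁p u∈X , u≢s)
                  , subst (_< k) (sym (∣δ∁∣≡∣δ∣ H X)) small

-- Dangerous sets

-- Lifting changes a cut by at most two edges, and only when both lifted ends lie inside.
gap-of-two : ∀ {k D L} {b} → k ≤ D → D ≤ L + 2 * 𝟙 b → L < k → b ≡ true × D ≤ k + 1
gap-of-two {k} {D} {L} {true}  k≤D D≤ L<k = refl , ≤-trans D≤ (subst (_≤ k + 1) (sym (+-suc L 1)) (+-monoˡ-≤ 1 L<k))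
gap-of-two {k} {D} {L} {false} k≤D D≤ L<k =
  contradiction (≤-trans k≤D (≤-trans D≤ (≤-reflexive (+-identityʳ L)))) (<⇒≱ L<k)

∧≡true : ∀ {a b} → (a ∧ b) ≡ true → a ≡ true × b ≡ true
∧≡true {true} {true} _ = refl , refl

-- Consequences of x + y ≤ 2k + 2 for the terms of a posimodular inequality.
diagonal-budget : ∀ {k a b w x y} → k ≤ a → k ≤ b → a + b + 2 * w ≤ x + y → x ≤ k + 1 → y ≤ k + 1 → w ≤ 1
diagonal-budget {k} {a} {b} {w} {x} {y} k≤a k≤b sum≤ x≤ y≤ = *-cancelˡ-≤ 2 (+-cancelˡ-≤ (k + k) (2 * w) 2 (begin
  k + k + 2 * w   ≤⟨ +-monoˡ-≤ (2 * w) (+-mono-≤ k≤a k≤b) ⟩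
  a + b + 2 * w   ≤⟨ sum≤ ⟩
  x + y           ≤⟨ +-mono-≤ x≤ y≤ ⟩
  k + 1 + (k + 1) ≡⟨ solve 1 (λ k → k :+ con 1 :+ (k :+ con 1) := k :+ k :+ con 2 :* con 1) refl k ⟩
  k + k + 2 * 1   ∎))
  where open ≤-Reasoning

difference-budget : ∀ {k a b w x y} → k ≤ b → 1 ≤ w → a + b + 2 * w ≤ x + y → x ≤ k + 1 → y ≤ k + 1 → a ≤ k
difference-budget {k} {a} {b} {w} {x} {y} k≤b 1≤w sum≤ x≤ y≤ = +-cancelʳ-≤ (k + 2) a k (begin
  a + (k + 2)     ≡⟨ solve 2 (λ a k → a :+ (k :+ con 2) := a :+ k :+ con 2 :* con 1) refl a k ⟩
  a + k + 2 * 1   ≤⟨ +-mono-≤ (+-monoʳ-≤ a k≤b) (*-monoʳ-≤ 2 1≤w) ⟩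
  a + b + 2 * w   ≤⟨ sum≤ ⟩
  x + y           ≤⟨ +-mono-≤ x≤ y≤ ⟩
  k + 1 + (k + 1) ≡⟨ solve 1 (λ k → k :+ con 1 :+ (k :+ con 1) := k :+ (k :+ con 2)) refl k ⟩
  k + (k + 2)     ∎)
  where open ≤-Reasoning

difference-surplus : ∀ {k a b w x y} → k ≤ a → k ≤ b → 1 ≤ w → a + b + 2 * w ≤ x + y → y ≤ k + 1 → k < x
difference-surplus {k} {a} {b} {w} {x} {y} k≤a k≤b 1≤w sum≤ y≤ =
  subst (_≤ x) (+-comm k 1) (+-cancelʳ-≤ (k + 1) (k + 1) x (begin
  k + 1 + (k + 1) ≡⟨ solve 1 (λ k → k :+ con 1 :+ (k :+ con 1) := k :+ k :+ con 2 :* con 1) refl k ⟩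
  k + k + 2 * 1   ≤⟨ +-mono-≤ (+-mono-≤ k≤a k≤b) (*-monoʳ-≤ 2 1≤w) ⟩
  a + b + 2 * w   ≤⟨ sum≤ ⟩
  x + y           ≤⟨ +-monoʳ-≤ x y≤ ⟩
  x + (k + 1)     ∎))
  where open ≤-Reasoning

module _ {n} (G : Graph n) (s : Fin n) where

  joins-s : ∀ {Z} e → IncidentWith G s e → otherEnd G s e ∈ Z → joins G ⁅ s ⁆ Z e ≡ true
  joins-s {Z} e inc v∈Z with proj₁ (ends G e) ≟ s | inc
  ... | yes refl | _ rewrite []=⇒lookup (x∈⁅x⁆ s) | []=⇒lookup v∈Z = refl
  ... | no  ≢s   | inj₁ ≡s = contradiction ≡s ≢s
  ... | no  _    | inj₂ refl rewrite []=⇒lookup (x∈⁅x⁆ s) | []=⇒lookup v∈Z = ∨-zeroʳ _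

  otherEnd≢s : Loopless G → ∀ e → IncidentWith G s e → otherEnd G s e ≢ s
  otherEnd≢s loopless e inc with proj₁ (ends G e) ≟ s | All.lookup loopless (∈-lookup e)
  ... | yes ≡s | nonloop = λ ≡s′ → nonloop (trans ≡s (sym ≡s′))
  ... | no  ≢s | _       = ≢s

  s-edges≤edgesBetween : ∀ Z {es : List (Edge G)} → Unique es →
    All (λ e → IncidentWith G s e × otherEnd G s e ∈ Z) es → length es ≤ edgesBetween G ⁅ s ⁆ Z
  s-edges≤edgesBetween Z unique ends-in-Z = unique-count (𝟙 ∘ joins G ⁅ s ⁆ Z) unique
    (All.map (λ (inc , v∈Z) → ≤-reflexive (sym (cong 𝟙 (joins-s _ inc v∈Z)))) ends-in-Z)

module _ {n} (G : Graph n) (s : Fin n) (k : ℕ) (conn : SKEdgeConnected G s k) where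

  private
    v : Edge G → Fin n
    v = otherEnd G s

  s∉dangerous : ∀ {X} → Dangerous G s k X → s ∉ X
  s∉dangerous = proj₁

  ∣δ∣-dangerous : ∀ {X} → Dangerous G s k X → ∣ δ G X ∣ ≤ k + 1
  ∣δ∣-dangerous = proj₂ ∘ proj₂ ∘ proj₂

  separating⇒k≤∣δ∣ : ∀ {X a b} → s ∉ X → a ∈ X → b ∉ X → b ≢ s → k ≤ ∣ δ G X ∣
  separating⇒k≤∣δ∣ {X} {a} {b} s∉X a∈X b∉X b≢s =
    edge-disjoint-paths⇒cut G (proj₂ (proj₂ conn) a b a≢s b≢s a≢b) X a∈X b∉X
    where
    a≢s : a ≢ s
    a≢s refl = s∉X a∈X
    a≢b : a ≢ b
    a≢b refl = b∉X a∈X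

  non-liftable⇒dangerous : ∀ e f → e ≢ f → IncidentWith G s e → IncidentWith G s f → ¬ Liftable G s k e f →
    ∃ λ X → Dangerous G s k X × otherEnd G s e ∈ X × otherEnd G s f ∈ X
  non-liftable⇒dangerous e f e≢f inc-e inc-f ¬liftable
    with ¬connected⇒small-cut (lift G s e f) s k (proj₁ conn) (proj₁ (proj₂ conn)) ¬liftable
  ... | X , s∉X , (a , a∈X) , (b , b∉X , b≢s) , small =
    X , (s∉X , (a , a∈X) , (b , b∉X , b≢s) , ∣δX∣≤k+1)
      , lookup⇒[]= _ X (proj₁ both-in) , lookup⇒[]= _ X (proj₂ both-in)
    where
    lifting = ∣δ∣≤∣δ-lift∣ G s X e f e≢f inc-e inc-f s∉X
    bound = gap-of-two (separating⇒k≤∣δ∣ s∉X a∈X b∉X b≢s) lifting small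
    ∣δX∣≤k+1 = proj₂ bound
    both-in = ∧≡true (proj₁ bound)

  k≤∣δ─∣ : ∀ {X Y a b} → s ∉ X → a ∈ X → a ∉ Y → b ∉ X ─ Y → b ≢ s → k ≤ ∣ δ G (X ─ Y) ∣
  k≤∣δ─∣ {X} {Y} s∉X a∈X a∉Y =
    separating⇒k≤∣δ∣ (s∉X ∘ p─q⊆p X Y) (x∈p∧x∉q⇒x∈p─q a∈X a∉Y)

  s-edge⇒1≤diagonal : ∀ {X Y} e → IncidentWith G s e → v e ∈ X → v e ∈ Y → s ∉ X → s ∉ Y → 1 ≤ diagonal G X Y
  s-edge⇒1≤diagonal {X} {Y} e inc vX vY s∉X s∉Y =
    ≤-trans (s-edges≤edgesBetween G s (X ∩ Y) ([] ∷ []) ((inc , x∈p∩q⁺ (vX , vY)) ∷ []))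
            (s-into-∩≤diagonal G s X Y (∉∪ s∉X s∉Y))

  crossing⇒diagonal≤1 : ∀ {X Y a b} → Dangerous G s k X → Dangerous G s k Y → a ∈ X → a ∉ Y → b ∈ Y → b ∉ X →
    diagonal G X Y ≤ 1
  crossing⇒diagonal≤1 {X} {Y} (s∉X , _ , _ , X≤) (s∉Y , _ , _ , Y≤) a∈X a∉Y b∈Y b∉X = diagonal-budget
    (k≤∣δ─∣ s∉X a∈X a∉Y (∈q⇒∉p─q b∈Y) (∈⇒≢ s∉Y b∈Y)) (k≤∣δ─∣ s∉Y b∈Y b∉X (∈q⇒∉p─q a∈X) (∈⇒≢ s∉X a∈X))
    (posimodular G X Y) X≤ Y≤

  nested : ∀ {X Y} → Dangerous G s k X → Dangerous G s k Y → 2 ≤ edgesBetween G ⁅ s ⁆ (X ∩ Y) → X ⊆ Y ⊎ Y ⊆ X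
  nested {X} {Y} dX dY 2≤
    with any? (λ z → z ∈? X ×-dec ¬? (z ∈? Y)) | any? (λ z → z ∈? Y ×-dec ¬? (z ∈? X))
  ... | no X─Y≡∅ | _         = inj₁ (no-difference⇒⊆ X─Y≡∅)
  ... | yes _    | no Y─X≡∅ = inj₂ (no-difference⇒⊆ Y─X≡∅)
  ... | yes (a , a∈X , a∉Y) | yes (b , b∈Y , b∉X) = contradiction
        (crossing⇒diagonal≤1 dX dY a∈X a∉Y b∈Y b∉X)
        (<⇒≱ (≤-trans 2≤ (s-into-∩≤diagonal G s X Y (∉∪ (s∉dangerous dX) (s∉dangerous dY)))))

  record Triangle (P Q R : Subset n) (α β γ : Edge G) : Set where
    field
      P-dangerous : Dangerous G s k P
      Q-dangerous : Dangerous G s k Q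
      R-dangerous : Dangerous G s k R
      α-at-s : IncidentWith G s α
      β-at-s : IncidentWith G s β
      γ-at-s : IncidentWith G s γ
      α∈P : v α ∈ P
      α∈Q : v α ∈ Q
      α∉R : v α ∉ R
      β∈P : v β ∈ P
      β∈R : v β ∈ R
      β∉Q : v β ∉ Q
      γ∈Q : v γ ∈ Q
      γ∈R : v γ ∈ R
      γ∉P : v γ ∉ P

  swap : ∀ {P Q R α β γ} → Triangle P Q R α β γ → Triangle Q P R α γ β
  swap t = record
    { P-dangerous = Q-dangerous ; Q-dangerous = P-dangerous ; R-dangerous = R-dangerous
    ; α-at-s = α-at-s ; β-at-s = γ-at-s ; γ-at-s = β-at-s
    ; α∈P = α∈Q ; α∈Q = α∈P ; α∉R = α∉R ; β∈P = γ∈Q ; β∈R = γ∈R ; β∉Q = γ∉P ; γ∈Q = β∈P ; γ∈R = β∈R ; γ∉P = β∉Q }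
    where open Triangle t

  rotate : ∀ {P Q R α β γ} → Triangle P Q R α β γ → Triangle R P Q β γ α
  rotate t = record
    { P-dangerous = R-dangerous ; Q-dangerous = P-dangerous ; R-dangerous = Q-dangerous
    ; α-at-s = β-at-s ; β-at-s = γ-at-s ; γ-at-s = α-at-s
    ; α∈P = β∈R ; α∈Q = β∈P ; α∉R = β∉Q ; β∈P = γ∈R ; β∈R = γ∈Q ; β∉Q = γ∉P ; γ∈Q = α∈P ; γ∈R = α∈Q ; γ∉P = α∉R }
    where open Triangle t

  -- A vertex of P outside Q ∪ R would make |δ(P − Q)| exceed k when P − Q is uncrossed with R,
  -- while uncrossing P with Q keeps it at most k.
  covered : ∀ {P Q R α β γ} → Triangle P Q R α β γ → P ⊆ Q ∪ R
  covered {P} {Q} {R} {α} {β} {γ} t {z} z∈P with z ∈? Q ∪ R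
  ... | yes z∈Q∪R = z∈Q∪R
  ... | no  z∉Q∪R = contradiction δA≤k (<⇒≱ k<δA)
    where
    open Triangle t
    s∉P = s∉dangerous P-dangerous
    s∉Q = s∉dangerous Q-dangerous
    s∉R = s∉dangerous R-dangerous
    A = P ─ Q
    s∉A : s ∉ A
    s∉A = ∉p⇒∉p─q s∉P
    β∈A : v β ∈ A
    β∈A = x∈p∧x∉q⇒x∈p─q β∈P β∉Q
    k<δA : k < ∣ δ G A ∣
    k<δA = difference-surplus
      (k≤∣δ─∣ s∉A (x∈p∧x∉q⇒x∈p─q z∈P (z∉Q∪R ∘ x∈p∪q⁺ ∘ inj₁)) (z∉Q∪R ∘ x∈p∪q⁺ ∘ inj₂)
              (∉p⇒∉p─q (∈q⇒∉p─q α∈Q)) (∈⇒≢ s∉P α∈P))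
      (k≤∣δ─∣ s∉R γ∈R (λ γ∈A → γ∉P (p─q⊆p P Q γ∈A)) (∉p⇒∉p─q α∉R) (∈⇒≢ s∉P α∈P))
      (s-edge⇒1≤diagonal β β-at-s β∈A β∈R s∉A s∉R)
      (posimodular G A R) (∣δ∣-dangerous R-dangerous)
    δA≤k : ∣ δ G A ∣ ≤ k
    δA≤k = difference-budget
      (k≤∣δ─∣ s∉Q γ∈Q γ∉P (∉p⇒∉p─q β∉Q) (∈⇒≢ s∉P β∈P))
      (s-edge⇒1≤diagonal α α-at-s α∈P α∈Q s∉P s∉Q)
      (posimodular G P Q) (∣δ∣-dangerous P-dangerous) (∣δ∣-dangerous Q-dangerous)

  -- For k ≤ 1 the s-edge α is alone in the cut of P − R.
  triangle⇒cut-edge : ∀ {P Q R α β γ} → k ≤ 1 → Triangle P Q R α β γ → CutEdge G α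
  triangle⇒cut-edge {P} {Q} {R} {α} {β} {γ} k≤1 t = alone-in-cut⇒cut-edge G A α α-crosses ∣δA∣≤1
    where
    open Triangle t
    A = P ─ R
    s∉P = s∉dangerous P-dangerous
    s∉R = s∉dangerous R-dangerous
    α-crosses : crosses G A α ≡ true
    α-crosses = trans (crosses-at-s G s A α α-at-s (∉p⇒∉p─q s∉P)) ([]=⇒lookup (x∈p∧x∉q⇒x∈p─q α∈P α∉R))
    ∣δA∣≤1 : ∣ δ G A ∣ ≤ 1
    ∣δA∣≤1 = difference-budget
      (≤-trans (proj₁ (proj₂ conn)) (k≤∣δ─∣ s∉R γ∈R γ∉P (∉p⇒∉p─q α∉R) (∈⇒≢ s∉P α∈P)))
      (s-edge⇒1≤diagonal β β-at-s β∈P β∈R s∉P s∉R)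
      (posimodular G P R)
      (≤-trans (∣δ∣-dangerous P-dangerous) (+-monoˡ-≤ 1 k≤1))
      (≤-trans (∣δ∣-dangerous R-dangerous) (+-monoˡ-≤ 1 k≤1))

  -- For k ≥ 2 the union of a triangle has at most three edges in its cut; it is dangerous
  -- unless it contains every vertex but s, in which case it receives four s-edges.
  triangle-union : Loopless G → ∀ {P Q R α β γ} → 2 ≤ k → Triangle P Q R α β γ →
    (∃ λ h → IncidentWith G s h × h ≢ α × h ≢ β × h ≢ γ) →
    ∃ λ U → Dangerous G s k U × P ⊆ U × v γ ∈ U
  triangle-union loopless {P} {Q} {R} {α} {β} {γ} 2≤k t (h , h-at-s , h≢α , h≢β , h≢γ) =
    decide (any? (λ b → ¬? (b ≟ s) ×-dec ¬? (b ∈? U)))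
    where
    open Triangle t
    U = P ∪ Q ∪ R
    P⊆U : P ⊆ U
    P⊆U = x∈p∪q⁺ ∘ inj₁
    Q⊆U : Q ⊆ U
    Q⊆U = x∈p∪q⁺ ∘ inj₂ ∘ x∈p∪q⁺ ∘ inj₁
    s∉U : s ∉ U
    s∉U = ∉∪ (s∉dangerous P-dangerous) (∉∪ (s∉dangerous Q-dangerous) (s∉dangerous R-dangerous))
    ∣δU∣≤3 : ∣ δ G U ∣ ≤ 3
    ∣δU∣≤3 = ≤-trans (∣δ∪∪∣≤diagonals G P Q R (covered t) (covered (swap t)) (covered (rotate t)))
      (+-mono-≤ (+-mono-≤ (crossing⇒diagonal≤1 P-dangerous Q-dangerous β∈P β∉Q γ∈Q γ∉P)
                          (crossing⇒diagonal≤1 P-dangerous R-dangerous α∈P α∉R γ∈R γ∉P))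
                (crossing⇒diagonal≤1 Q-dangerous R-dangerous α∈Q α∉R β∈R β∉Q))
    distinct : ∀ {e f Z} → v e ∈ Z → v f ∉ Z → e ≢ f
    distinct e∈Z f∉Z refl = f∉Z e∈Z
    decide : Dec (∃ λ b → b ≢ s × b ∉ U) → ∃ λ U → Dangerous G s k U × P ⊆ U × v γ ∈ U
    decide (yes (b , b≢s , b∉U)) =
      U , (s∉U , (v α , P⊆U α∈P) , (b , b∉U , b≢s) , ≤-trans ∣δU∣≤3 (+-monoˡ-≤ 1 2≤k)) , P⊆U , Q⊆U γ∈Q
    decide (no U-full) = contradiction (≤-trans four≤ (≤-trans (edgesBetween-s≤∣δ∣ G s U s∉U) ∣δU∣≤3)) (<⇒≱ ≤-refl)
      where
      h∈U : v h ∈ U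
      h∈U with v h ∈? U
      ... | yes h∈U = h∈U
      ... | no  h∉U = contradiction (v h , otherEnd≢s G s loopless h h-at-s , h∉U) U-full
      four≤ : 4 ≤ edgesBetween G ⁅ s ⁆ U
      four≤ = s-edges≤edgesBetween G s U
        ((distinct α∈Q β∉Q ∷ distinct α∈P γ∉P ∷ (h≢α ∘ sym) ∷ []) ∷ (distinct β∈P γ∉P ∷ (h≢β ∘ sym) ∷ [])
          ∷ ((h≢γ ∘ sym) ∷ []) ∷ [] ∷ [])
        ((α-at-s , P⊆U α∈P) ∷ (β-at-s , P⊆U β∈P) ∷ (γ-at-s , Q⊆U γ∈Q) ∷ (h-at-s , h∈U) ∷ [])

-- The minimal dangerous set

dangerous? : ∀ {n} (G : Graph n) s k → Decidable (Dangerous G s k)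
dangerous? G s k A = ¬? (s ∈? A) ×-dec (nonempty? A ×-dec
  (any? (λ x → ¬? (x ∈? A) ×-dec ¬? (x ≟ s)) ×-dec (∣ δ G A ∣ ≤? k + 1)))

module IndependentSet {n} (G : Graph n) (s : Fin n) (k : ℕ)
         (loopless : Loopless G) (conn : SKEdgeConnected G s k)
         (no-cut-edge : ∀ e → IncidentWith G s e → ¬ CutEdge G e)
         (I : Subset (length G)) (I-at-s : IsLVertexSet G s I) (independent : IndependentInL G s k I)
         (outside-I : ∃ λ h → IncidentWith G s h × h ∉ I) where

  private
    v : Edge G → Fin n
    v = otherEnd G s

  pair⇒dangerous : ∀ {e f} → e ∈ I → f ∈ I → e ≢ f → ∃ λ X → Dangerous G s k X × v e ∈ X × v f ∈ X
  pair⇒dangerous {e} {f} e∈I f∈I e≢f =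
    non-liftable⇒dangerous G s k conn e f e≢f (I-at-s e e∈I) (I-at-s f f∈I) λ liftable →
      independent e f e∈I f∈I (I-at-s e e∈I) (I-at-s f f∈I) (e≢f , liftable)

  nested-at-pair : ∀ {X Y e f} → Dangerous G s k X → Dangerous G s k Y → e ∈ I → f ∈ I → e ≢ f →
    v e ∈ X → v f ∈ X → v e ∈ Y → v f ∈ Y → X ⊆ Y ⊎ Y ⊆ X
  nested-at-pair {X} {Y} {e} {f} dX dY e∈I f∈I e≢f eX fX eY fY = nested G s k conn dX dY
    (s-edges≤edgesBetween G s (X ∩ Y) ((e≢f ∷ []) ∷ [] ∷ [])
      ((I-at-s e e∈I , x∈p∩q⁺ (eX , eY)) ∷ (I-at-s f f∈I , x∈p∩q⁺ (fX , fY)) ∷ []))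

  Extension : Subset n → Edge G → Set
  Extension X g = ∃ λ X′ → Dangerous G s k X′ × X ⊆ X′ × v g ∈ X′

  absorb : ∀ {X Z g} → v g ∉ X → Dangerous G s k Z → v g ∈ Z → X ⊆ Z ⊎ Z ⊆ X → Extension X g
  absorb {Z = Z} g∉X dZ gZ (inj₁ X⊆Z) = Z , dZ , X⊆Z , gZ
  absorb         g∉X dZ gZ (inj₂ Z⊆X) = contradiction (Z⊆X gZ) g∉X

  triangle-extension : ∀ {X Y W α β γ} → α ∈ I → β ∈ I → γ ∈ I → Triangle G s k conn X Y W α β γ → Extension X γ
  triangle-extension {α = α} {β} {γ} α∈I β∈I γ∈I t with k ≤? 1
  ... | yes k≤1 = contradiction (triangle⇒cut-edge G s k conn k≤1 t) (no-cut-edge α (I-at-s α α∈I))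
  ... | no  k≰1 = triangle-union G s k conn loopless (≰⇒> k≰1) t
                    (h , h-at-s , (λ { refl → h∉I α∈I }) , (λ { refl → h∉I β∈I }) , (λ { refl → h∉I γ∈I }))
    where
    h = proj₁ outside-I
    h-at-s = proj₁ (proj₂ outside-I)
    h∉I = proj₂ (proj₂ outside-I)

  -- Y and W are the dangerous sets witnessing that e, g and f, g are not liftable.
  extend-by : ∀ {X Y W e f g} → Dangerous G s k X → Dangerous G s k Y → Dangerous G s k W →
    e ∈ I → f ∈ I → g ∈ I → e ≢ f → v e ∈ X → v f ∈ X → v g ∉ X → v e ∈ Y → v g ∈ Y → v f ∈ W → v g ∈ W →
    Extension X g
  extend-by {X} {Y} {W} {e} {f} {g} dX dY dW e∈I f∈I g∈I e≢f eX fX g∉X eY gY fW gW with v f ∈? Y | v e ∈? W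
  ... | yes fY | _      = absorb g∉X dY gY (nested-at-pair dX dY e∈I f∈I e≢f eX fX eY fY)
  ... | no  _  | yes eW = absorb g∉X dW gW (nested-at-pair dX dW e∈I f∈I e≢f eX fX eW fW)
  ... | no f∉Y | no e∉W = triangle-extension e∈I f∈I g∈I record
    { P-dangerous = dX ; Q-dangerous = dY ; R-dangerous = dW
    ; α-at-s = I-at-s e e∈I ; β-at-s = I-at-s f f∈I ; γ-at-s = I-at-s g g∈I
    ; α∈P = eX ; α∈Q = eY ; α∉R = e∉W ; β∈P = fX ; β∈R = fW ; β∉Q = f∉Y ; γ∈Q = gY ; γ∈R = gW ; γ∉P = g∉X }

  extend : ∀ {X e f g} → Dangerous G s k X → e ∈ I → f ∈ I → g ∈ I → e ≢ f → v e ∈ X → v f ∈ X → v g ∉ X →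
    Extension X g
  extend dX e∈I f∈I g∈I e≢f eX fX g∉X =
    let (_ , dY , eY , gY) = pair⇒dangerous e∈I g∈I (λ { refl → g∉X eX })
        (_ , dW , fW , gW) = pair⇒dangerous f∈I g∈I (λ { refl → g∉X fX })
    in extend-by dX dY dW e∈I f∈I g∈I e≢f eX fX g∉X eY gY fW gW

  ContainsEnds : Subset n → List (Edge G) → Set
  ContainsEnds X gs = ∀ g → g ∈ₗ gs → g ∈ I → v g ∈ X

  dangerous-containing : ∀ {e f} → e ∈ I → f ∈ I → e ≢ f → (gs : List (Edge G)) →
    ∃ λ X → Dangerous G s k X × v e ∈ X × v f ∈ X × ContainsEnds X gs
  dangerous-containing e∈I f∈I e≢f [] =
    let (X , dX , eX , fX) = pair⇒dangerous e∈I f∈I e≢f in X , dX , eX , fX , λ _ ()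
  dangerous-containing {e} {f} e∈I f∈I e≢f (g ∷ gs) = add-edge (dangerous-containing e∈I f∈I e≢f gs)
    where
    add-edge : (∃ λ X → Dangerous G s k X × v e ∈ X × v f ∈ X × ContainsEnds X gs) →
               ∃ λ X → Dangerous G s k X × v e ∈ X × v f ∈ X × ContainsEnds X (g ∷ gs)
    add-edge (X , dX , eX , fX , gsX) with g ∈? I | v g ∈? X
    ... | no  g∉I | _      = X , dX , eX , fX ,
                               λ { _ (here refl) g∈I → contradiction g∈I g∉I ; g′ (there g′∈) → gsX g′ g′∈ }
    ... | yes _   | yes gX = X , dX , eX , fX , λ { _ (here refl) _ → gX ; g′ (there g′∈) → gsX g′ g′∈ }
    ... | yes g∈I | no g∉X =
          let (X′ , dX′ , X⊆X′ , gX′) = extend dX e∈I f∈I g∈I e≢f eX fX g∉X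
          in X′ , dX′ , X⊆X′ eX , X⊆X′ fX , λ { _ (here refl) _ → gX′ ; g′ (there g′∈) g′∈I → X⊆X′ (gsX g′ g′∈ g′∈I) }

  Candidate : Subset n → Set
  Candidate A = Dangerous G s k A × (∀ e → e ∈ I → otherEnd G s e ∈ A)

  candidate? : Decidable Candidate
  candidate? A = dangerous? G s k A ×-dec all? (λ e → e ∈? I →-dec otherEnd G s e ∈? A)

  candidate-exists : ∀ {e f} → e ∈ I → f ∈ I → e ≢ f → ∃ Candidate
  candidate-exists e∈I f∈I e≢f =
    let (X , dX , _ , _ , ends∈X) = dangerous-containing
                                      e∈I f∈I e≢f (allFin (length G))
    in X , dX , λ g g∈I → ends∈X g (∈-allFin g) g∈I

  candidates-nested : ∀ {e f A B} → e ∈ I → f ∈ I → e ≢ f → Candidate A → Candidate B → A ⊆ B ⊎ B ⊆ A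
  candidates-nested e∈I f∈I e≢f (dA , A-ends) (dB , B-ends) =
    nested-at-pair dA dB e∈I f∈I e≢f
      (A-ends _ e∈I) (A-ends _ f∈I) (B-ends _ e∈I) (B-ends _ f∈I)

lemma2p5 : ∀ {n} (G : Graph n) (s : Fin n) (k : ℕ) →
    Loopless G →
    SKEdgeConnected G s k →
    (∀ e → IncidentWith G s e → ¬ CutEdge G e) →
    (I : Subset (length G)) →
    IsLVertexSet G s I →
    IndependentInL G s k I →
    2 ≤ ∣ I ∣ →
    (∃ λ e → IncidentWith G s e × e ∉ I) →
    let Cand : Subset n → Set
        Cand A = Dangerous G s k A × (∀ e → e ∈ I → otherEnd G s e ∈ A)
        Minimal : Subset n → Set
        Minimal A = Cand A × (∀ B → Cand B → B ⊆ A → B ≡ A)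
    in Σ (Subset n) λ A → Minimal A × (∀ B → Minimal B → B ≡ A)
lemma2p5 G s k loopless conn no-cut-edge I I-at-s independent 2≤∣I∣ outside-I =
  let (e , f , e≢f , e∈I , f∈I) = two-members I 2≤∣I∣
      (M , M-candidate , M-minimal) = minimal-member candidate? (proj₂ (candidate-exists e∈I f∈I e≢f))
  in M , (M-candidate , M-minimal) , λ B (B-candidate , B-minimal) →
       [ M-minimal B B-candidate , sym ∘ B-minimal M M-candidate ]
         (candidates-nested e∈I f∈I e≢f B-candidate M-candidate)
  where open IndependentSet G s k loopless conn no-cut-edge I I-at-s independent outside-I
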